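{- Let $n\ge12$. There do not exist a graph $G$ and graphs $H_\lambda$ ($\lambda\vdash n$) such that the functions $X_G^{H_\lambda}$ span $\Lambda^n$, even if $G$ and the $H_\lambda$ are allowed to have loops.
   Context: Graphs are finite and may have loops; a vertex with a loop counts as adjacent to itself. A graph homomorphism $f:G\to H$ is a map $V(G)\to V(H)$ such that whenever $u,v$ are adjacent in $G$ (possibly $u=v$ via a loop), $f(u),f(v)$ are adjacent in $H$. Its type is the partition of nonzero preimage sizes. For a partition $\lambda$ with $r_i(\lambda)$ parts equal to $i$ and $\ell(\lambda)\le N$, $m_\lambda^N=\frac{N!}{\binom{N}{r_1(\lambda),r_2(\lambda),\dots,N-\ell(\lambda)}}m_\lambda$ with $m_\lambda$ the monomial symmetric function. The $H$-chromatic symmetric function is $X_G^H=\sum_\lambda d_\lambda m_\lambda^{|V(H)|}$, $d_\lambda$ the number of homomorphisms $G\to H$ of type $\lambda$. $\Lambda^n$ is the $\mathbb{Q}$-vector space of homogeneous symmetric functions of degree $n$. -}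

module Defs where

open import Data.Bool using (Bool; true; false; if_then_else_; _∧_; _∨_; not)
open import Data.Nat as ℕ using (ℕ; zero; suc; _∸_; _≤ᵇ_; _<_; _!)
open import Data.Nat.ListAction using (sum; product)
open import Data.Fin as Fin using (Fin)
open import Data.List using (List; []; _∷_; allFin; map; filter; length; concatMap; foldr; upTo)
open import Data.Bool.ListAction using (and)
open import Data.List.Relation.Unary.All using (All)
open import Data.List.Relation.Unary.Linked using (Linked)
open import Data.Vec.Functional using () renaming (_∷_ to _∷ᶠ_)
open import Data.Product using (Σ; _×_; _,_; proj₁; ∃)
open import Data.Integer using (+_)
open import Data.Rational using (ℚ; _/_; 0ℚ) renaming (_+_ to _+ℚ_; _*_ to _*ℚ_)
open import Relation.Binary.PropositionalEquality using (_≡_; _≢_)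
open import Relation.Nullary.Decidable using (⌊_⌋)
import Data.List.Properties as LP
import Data.Nat.Properties as NP

-- Finite graphs (loops allowed): vertex set Fin size, symmetric Boolean
-- adjacency; adj v v ≡ true means v carries a loop.

record Graph : Set where
  field
    size : ℕ
    adj  : Fin size → Fin size → Bool
    sym  : ∀ u v → adj u v ≡ adj v u
open Graph public

IsPartition : List ℕ → Set
IsPartition l = All (0 <_) l × Linked ℕ._≥_ l

Partition : Set
Partition = Σ (List ℕ) IsPartition

∣_∣ₚ : Partition → ℕ
∣ μ , _ ∣ₚ = sum μ

Par : ℕ → Set
Par n = Σ Partition (λ μ → ∣ μ ∣ₚ ≡ n)

allFuns : (k N : ℕ) → List (Fin k → Fin N)
allFuns zero    N = (λ ()) ∷ []
allFuns (suc k) N = concatMap (λ f → map (λ w → w ∷ᶠ f) (allFin N)) (allFuns k N)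

isHom : (G H : Graph) → (Fin (size G) → Fin (size H)) → Bool
isHom G H f = and (concatMap (λ u → map (λ v → not (adj G u v) ∨ adj H (f u) (f v))
                                         (allFin (size G)))
                             (allFin (size G)))

preimage : ∀ {k N} → (Fin k → Fin N) → Fin N → ℕ
preimage {k} f w = length (filter (λ u → f u Fin.≟ w) (allFin k))

insertDesc : ℕ → List ℕ → List ℕ
insertDesc x []       = x ∷ []
insertDesc x (y ∷ ys) = if y ≤ᵇ x then x ∷ y ∷ ys else y ∷ insertDesc x ys

sortDesc : List ℕ → List ℕ
sortDesc = foldr insertDesc []

typeOf : ∀ {k N} → (Fin k → Fin N) → List ℕ
typeOf {k} {N} f = sortDesc (filter (λ s → 1 ℕ.≤? s) (map (preimage f) (allFin N)))

homCount : (G H : Graph) → Partition → ℕ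
homCount G H (μ , _) =
  length (filter (λ f → LP.≡-dec ℕ._≟_ (typeOf f) μ)
                 (filter (λ f → isHom G H f Data.Bool.≟ true) (allFuns (size G) (size H))))
  where import Data.Bool

mult : ℕ → List ℕ → ℕ
mult i μ = length (filter (λ j → j ℕ.≟ i) μ)

-- m_μ^N = (N! / multinomial(N; r_1(μ), r_2(μ), …, N - ℓ(μ))) m_μ
--       = r_1(μ)! r_2(μ)! ⋯ (N - ℓ(μ))! · m_μ      (for ℓ(μ) ≤ N)
mScalar : ℕ → Partition → ℕ
mScalar N (μ , _) = product (map (λ i → (mult (suc i) μ) !) (upTo (sum μ))) ℕ.* ((N ∸ length μ) !)

-- Symmetric functions are represented by their coordinates in the
-- monomial basis {m_μ}: a function Partition → ℚ (the elements considered
-- below always have finite support).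

SymFun : Set
SymFun = Partition → ℚ

ℕ→ℚ : ℕ → ℚ
ℕ→ℚ n = + n / 1

-- X_G^H = Σ_μ d_μ m_μ^{|V(H)|}, coefficient of m_μ:
X : Graph → Graph → SymFun
X G H μ = ℕ→ℚ (homCount G H μ ℕ.* mScalar (size H) μ)

InΛ : ℕ → SymFun → Set
InΛ n v = ∀ μ → ∣ μ ∣ₚ ≢ n → v μ ≡ 0ℚ

linComb : {I : Set} → (I → SymFun) → List (ℚ × I) → SymFun
linComb F L μ = foldr (λ { (c , i) acc → (c *ℚ F i μ) +ℚ acc }) 0ℚ L

Spans : (n : ℕ) {I : Set} → (I → SymFun) → Set
Spans n {I} F =
  (∀ i → InΛ n (F i)) ×
  (∀ (v : SymFun) → InΛ n v → ∃ λ (L : List (ℚ × I)) → ∀ μ → linComb F L μ ≡ v μ)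

-- For a partition λ = (a, b) of n = |V(G)| with two parts, a map of type λ has exactly two
-- fibres, so the coefficient of m_λ in X_G^H is (|V(H)| - 2)! times the number of pairs
-- x ≠ y of vertices of H together with a homomorphism from G into the subgraph induced on
-- {x, y} whose fibres over x and y have sizes a and b.  On the six partitions (n - k, k),
-- 1 ≤ k ≤ 6 (two-part partitions because n ≥ 12), X_G^H is therefore a combination of the
-- vectors v(p, e, q) counting such homomorphisms into the two-vertex graph with loops p, q
-- and edge e, the pairs (x, y) and (y, x) together contributing v(p, e, q) + v(q, e, p).
-- If G has an edge then v(false, false, false) = 0; otherwise every map is a homomorphism and all the
-- v(p, e, q) coincide.  Either way all X_G^H lie in the span of five vectors of ℚ⁶, so a
-- nonzero linear form on these six coordinates kills every X_G^H but not every m_λ.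

module Submission where

open import Algebra.Bundles using (CommutativeSemiring; CommutativeRing)
open import Data.Bool using (Bool; true; false; not; _∨_; if_then_else_)
import Data.Bool as Bool
import Data.Bool.Properties as Bool
open import Data.Bool.ListAction using (and)
open import Data.Empty using (⊥)
open import Data.Fin as Fin using (Fin; zero; suc; toℕ; punchIn; punchOut)
import Data.Fin.Properties as Fin
import Data.Integer as ℤ
import Data.Integer.Properties as ℤ
open import Data.List using (List; []; _∷_; _++_; length; map; concatMap; filter; allFin; tabulate; applyUpTo; upTo)
import Data.List.Properties as List
open import Data.List.Membership.Propositional using (_∈_; _∉_)
open import Data.List.Membership.Propositional.Properties using (∈-allFin; ∈-∃++)
open import Data.List.Relation.Binary.Permutation.Propositional using (_↭_; prep; swap; ↭-refl; ↭-trans)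
open import Data.List.Relation.Binary.Permutation.Propositional.Properties using (↭-length; shift; ∈-resp-↭; All-resp-↭; filter-↭)
open import Data.List.Relation.Unary.All as All using (All; []; _∷_)
open import Data.List.Relation.Unary.All.Properties using (¬Any⇒All¬; all-filter; concat⁻; map⁻)
open import Data.List.Relation.Unary.Any as Any using (here; there)
open import Data.List.Relation.Unary.Linked using ([-]; _∷_)
open import Data.Nat as ℕ using (ℕ; _≤_)
open import Data.Nat.Coprimality using (1-coprimeTo) renaming (sym to coprime-sym)
open import Data.Nat.ListAction using (sum; product)
open import Data.Nat.ListAction.Properties using (sum-↭)
import Data.Nat.Properties as ℕ
import Data.Nat.Solver as ℕ-Solver
open import Data.Product using (Σ; ∃; ∃₂; _×_; _,_; proj₁; proj₂)
import Data.Rational as ℚ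
import Data.Rational.Properties as ℚ
import Data.Rational.Solver as ℚ-Solver
open import Data.Sum using (_⊎_; inj₁; inj₂; [_,_]; [_,_]′)
open import Data.Vec.Functional using (Vector) renaming (_∷_ to _∷ᶠ_)
open import Function using (_∘_)
import Relation.Binary.PropositionalEquality as ≡
open ≡ using (_≡_; _≢_)
open import Relation.Nullary using (Dec; yes; no; does; ¬_; ¬?; contradiction)
open import Relation.Nullary.Decidable using (decidable-stable; toSum)
open import Relation.Unary using (Pred; Decidable)

open import Defs hiding (sym)

module Sums {c ℓ} (R : CommutativeSemiring c ℓ) where

  open import Data.Fin using (_≟_)
  open CommutativeSemiring R hiding (zero)
  open import Algebra.Properties.CommutativeSemigroup +-commutativeSemigroup using () renaming (x∙yz≈y∙xz to x+[y+z]≈y+[x+z])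
  open import Relation.Binary.Reasoning.Setoid setoid

  ∑ : {A : Set} → List A → (A → Carrier) → Carrier
  ∑ []       f = 0#
  ∑ (x ∷ xs) f = f x + ∑ xs f

  syntax ∑ xs (λ x → e) = ∑[ x ∈ xs ] e

  𝟙 : {P : Set} → Dec P → Carrier
  𝟙 d = if does d then 1# else 0#

  module _ {A : Set} where

    ∑-cong : ∀ (xs : List A) {f g : A → Carrier} → (∀ x → f x ≈ g x) → ∑ xs f ≈ ∑ xs g
    ∑-cong []       f≈g = refl
    ∑-cong (x ∷ xs) f≈g = +-cong (f≈g x) (∑-cong xs f≈g)

    ∑-zero : ∀ (xs : List A) {f : A → Carrier} → (∀ x → f x ≈ 0#) → ∑ xs f ≈ 0#
    ∑-zero []       f≈0 = refl
    ∑-zero (x ∷ xs) f≈0 = trans (+-cong (f≈0 x) (∑-zero xs f≈0)) (+-identityˡ 0#)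

    ∑-distrib-+ : ∀ (xs : List A) (f g : A → Carrier) → ∑[ x ∈ xs ] (f x + g x) ≈ ∑ xs f + ∑ xs g
    ∑-distrib-+ []       f g = sym (+-identityˡ 0#)
    ∑-distrib-+ (x ∷ xs) f g = begin
      (f x + g x) + ∑[ y ∈ xs ] (f y + g y) ≈⟨ +-congˡ (∑-distrib-+ xs f g) ⟩
      (f x + g x) + (∑ xs f + ∑ xs g)      ≈⟨ +-assoc _ _ _ ⟩
      f x + (g x + (∑ xs f + ∑ xs g))      ≈⟨ +-congˡ (x+[y+z]≈y+[x+z] (g x) (∑ xs f) (∑ xs g)) ⟩
      f x + (∑ xs f + (g x + ∑ xs g))      ≈⟨ sym (+-assoc _ _ _) ⟩
      (f x + ∑ xs f) + (g x + ∑ xs g)      ∎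

    *-distribˡ-∑ : ∀ (xs : List A) a (f : A → Carrier) → a * ∑ xs f ≈ ∑[ x ∈ xs ] (a * f x)
    *-distribˡ-∑ []       a f = zeroʳ a
    *-distribˡ-∑ (x ∷ xs) a f = trans (distribˡ a (f x) _) (+-congˡ (*-distribˡ-∑ xs a f))

    *-distribʳ-∑ : ∀ (xs : List A) a (f : A → Carrier) → ∑ xs f * a ≈ ∑[ x ∈ xs ] (f x * a)
    *-distribʳ-∑ xs a f = trans (*-comm _ a) (trans (*-distribˡ-∑ xs a f) (∑-cong xs (λ x → *-comm a (f x))))

    ∑-++ : ∀ (xs ys : List A) (f : A → Carrier) → ∑ (xs ++ ys) f ≈ ∑ xs f + ∑ ys f
    ∑-++ []       ys f = sym (+-identityˡ _)
    ∑-++ (x ∷ xs) ys f = trans (+-congˡ (∑-++ xs ys f)) (sym (+-assoc _ _ _))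

    ∑-filter : ∀ {P : Pred A _} (P? : Decidable P) (xs : List A) (f : A → Carrier) →
               ∑ (filter P? xs) f ≈ ∑[ x ∈ xs ] (𝟙 (P? x) * f x)
    ∑-filter P? []       f = refl
    ∑-filter P? (x ∷ xs) f with P? x
    ... | yes _ = +-cong (sym (*-identityˡ (f x))) (∑-filter P? xs f)
    ... | no  _ = trans (sym (+-identityˡ _)) (+-cong (sym (zeroˡ (f x))) (∑-filter P? xs f))

  module _ {A B : Set} where

    ∑-comm : ∀ (xs : List A) (ys : List B) (f : A → B → Carrier) →
             ∑[ x ∈ xs ] ∑[ y ∈ ys ] f x y ≈ ∑[ y ∈ ys ] ∑[ x ∈ xs ] f x y
    ∑-comm []       ys f = sym (∑-zero ys (λ _ → refl))
    ∑-comm (x ∷ xs) ys f = trans (+-congˡ (∑-comm xs ys f)) (sym (∑-distrib-+ ys (f x) _))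

    ∑-map : ∀ (g : A → B) (xs : List A) (f : B → Carrier) → ∑ (map g xs) f ≈ ∑[ x ∈ xs ] f (g x)
    ∑-map g []       f = refl
    ∑-map g (x ∷ xs) f = +-congˡ (∑-map g xs f)

    ∑-concatMap : ∀ (g : A → List B) (xs : List A) (f : B → Carrier) →
                  ∑ (concatMap g xs) f ≈ ∑[ x ∈ xs ] ∑ (g x) f
    ∑-concatMap g []       f = refl
    ∑-concatMap g (x ∷ xs) f = trans (∑-++ (g x) (concatMap g xs) f) (+-congˡ (∑-concatMap g xs f))

  ∑-allFin-suc : ∀ n (f : Fin (ℕ.suc n) → Carrier) → ∑ (allFin (ℕ.suc n)) f ≈ f zero + ∑[ i ∈ allFin n ] f (suc i)
  ∑-allFin-suc n f = +-congˡ (begin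
    ∑ (tabulate suc) f          ≡⟨ ≡.cong (λ xs → ∑ xs f) (≡.sym (List.map-tabulate (λ i → i) suc)) ⟩
    ∑ (map suc (allFin n)) f    ≈⟨ ∑-map suc (allFin n) f ⟩
    ∑[ i ∈ allFin n ] f (suc i) ∎)

  ∑-δ : ∀ n (i : Fin n) (f : Fin n → Carrier) → ∑[ j ∈ allFin n ] (𝟙 (i ≟ j) * f j) ≈ f i
  ∑-δ (ℕ.suc n) i f = trans (∑-allFin-suc n _) (δ i)
    where
    δ : ∀ i → 𝟙 (i ≟ zero) * f zero + ∑[ j ∈ allFin n ] (𝟙 (i ≟ suc j) * f (suc j)) ≈ f i
    δ zero    = trans (+-cong (*-identityˡ _) (∑-zero (allFin n) (λ _ → zeroˡ _))) (+-identityʳ _)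
    δ (suc i) = trans (+-cong (zeroˡ _) (∑-δ n i (f ∘ suc))) (+-identityˡ _)

  ∑-supported-on-pair : ∀ n {x y : Fin n} (f : Fin n → Carrier) → x ≢ y →
                        (∀ w → w ≢ x → w ≢ y → f w ≈ 0#) → ∑[ w ∈ allFin n ] f w ≈ f x + f y
  ∑-supported-on-pair n {x} {y} f x≢y vanish = begin
    ∑[ w ∈ allFin n ] f w                                        ≈⟨ ∑-cong (allFin n) split ⟩
    ∑[ w ∈ allFin n ] (𝟙 (x ≟ w) * f w + 𝟙 (y ≟ w) * f w)        ≈⟨ ∑-distrib-+ (allFin n) _ _ ⟩
    ∑[ w ∈ allFin n ] (𝟙 (x ≟ w) * f w) + ∑[ w ∈ allFin n ] (𝟙 (y ≟ w) * f w) ≈⟨ +-cong (∑-δ n x f) (∑-δ n y f) ⟩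
    f x + f y                                                    ∎
    where
    split : ∀ w → f w ≈ 𝟙 (x ≟ w) * f w + 𝟙 (y ≟ w) * f w
    split w with x ≟ w | y ≟ w
    ... | yes ≡.refl | yes ≡.refl = contradiction ≡.refl x≢y
    ... | yes ≡.refl | no _       = sym (trans (+-cong (*-identityˡ _) (zeroˡ _)) (+-identityʳ _))
    ... | no _       | yes ≡.refl = sym (trans (+-cong (zeroˡ _) (*-identityˡ _)) (+-identityˡ _))
    ... | no x≢w     | no y≢w     = trans (vanish w (x≢w ∘ ≡.sym) (y≢w ∘ ≡.sym)) (sym (trans (+-cong (zeroˡ _) (zeroˡ _)) (+-identityˡ 0#)))

  ∑-𝟙-≟ : ∀ n (i : Fin n) → ∑[ j ∈ allFin n ] 𝟙 (i ≟ j) ≈ 1#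
  ∑-𝟙-≟ n i = trans (∑-cong (allFin n) (λ j → sym (*-identityʳ (𝟙 (i ≟ j))))) (∑-δ n i (λ _ → 1#))

  𝟙-cong : ∀ {P Q : Set} (p : Dec P) (q : Dec Q) → (P → Q) → (Q → P) → 𝟙 p ≈ 𝟙 q
  𝟙-cong (yes _) (yes _) _   _   = refl
  𝟙-cong (no _)  (no _)  _   _   = refl
  𝟙-cong (yes p) (no ¬q) p→q _   = contradiction (p→q p) ¬q
  𝟙-cong (no ¬p) (yes q) _   q→p = contradiction (q→p q) ¬p

  𝟙-yes : ∀ {P : Set} (p : Dec P) → P → 𝟙 p ≈ 1#
  𝟙-yes (yes _) _  = refl
  𝟙-yes (no ¬p) p = contradiction p ¬p

  𝟙-no : ∀ {P : Set} (p : Dec P) → ¬ P → 𝟙 p ≈ 0#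
  𝟙-no (yes p) ¬p = contradiction p ¬p
  𝟙-no (no _)  _  = refl

  ∑-product-split-diagonal : ∀ n (f g : Fin n → Carrier) →
    ∑ (allFin n) f * ∑ (allFin n) g ≈
    ∑[ x ∈ allFin n ] ∑[ y ∈ allFin n ] (𝟙 (¬? (x ≟ y)) * (f x * g y)) + ∑[ x ∈ allFin n ] (f x * g x)
  ∑-product-split-diagonal n f g = begin
    ∑ (allFin n) f * ∑ (allFin n) g                                   ≈⟨ *-distribʳ-∑ (allFin n) _ f ⟩
    ∑[ x ∈ allFin n ] (f x * ∑ (allFin n) g)                          ≈⟨ ∑-cong (allFin n) row ⟩
    ∑[ x ∈ allFin n ] (∑[ y ∈ allFin n ] (𝟙 (¬? (x ≟ y)) * (f x * g y)) + f x * g x) ≈⟨ ∑-distrib-+ (allFin n) _ _ ⟩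
    ∑[ x ∈ allFin n ] ∑[ y ∈ allFin n ] (𝟙 (¬? (x ≟ y)) * (f x * g y)) + ∑[ x ∈ allFin n ] (f x * g x) ∎
    where
    off+on : ∀ x y → f x * g y ≈ 𝟙 (¬? (x ≟ y)) * (f x * g y) + 𝟙 (x ≟ y) * (f x * g y)
    off+on x y with x ≟ y
    ... | yes _ = sym (trans (+-cong (zeroˡ _) (*-identityˡ _)) (+-identityˡ _))
    ... | no _  = sym (trans (+-cong (*-identityˡ _) (zeroˡ _)) (+-identityʳ _))
    row : ∀ x → f x * ∑ (allFin n) g ≈ ∑[ y ∈ allFin n ] (𝟙 (¬? (x ≟ y)) * (f x * g y)) + f x * g x
    row x = begin
      f x * ∑ (allFin n) g                                             ≈⟨ *-distribˡ-∑ (allFin n) (f x) g ⟩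
      ∑[ y ∈ allFin n ] (f x * g y)                                    ≈⟨ ∑-cong (allFin n) (off+on x) ⟩
      ∑[ y ∈ allFin n ] (𝟙 (¬? (x ≟ y)) * (f x * g y) + 𝟙 (x ≟ y) * (f x * g y)) ≈⟨ ∑-distrib-+ (allFin n) _ _ ⟩
      ∑[ y ∈ allFin n ] (𝟙 (¬? (x ≟ y)) * (f x * g y)) + ∑[ y ∈ allFin n ] (𝟙 (x ≟ y) * (f x * g y))
                                                                        ≈⟨ +-congˡ (∑-δ n x (λ y → f x * g y)) ⟩
      ∑[ y ∈ allFin n ] (𝟙 (¬? (x ≟ y)) * (f x * g y)) + f x * g x     ∎

module Counting where

  open import Data.Nat using (zero; suc; _+_; _*_; _<_; _≟_; _≤ᵇ_; _∸_; _!; z≤n; s≤s; s<s)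
  open ≡ hiding ([_])
  open import Data.List.Membership.DecPropositional _≟_ using (_∈?_)
  open import Algebra.Properties.CommutativeSemigroup ℕ.*-commutativeSemigroup using (x∙yz≈y∙xz)
  open Sums ℕ.+-*-commutativeSemiring

  length-filter≡∑𝟙 : ∀ {A : Set} {P : Pred A _} (P? : Decidable P) xs → length (filter P? xs) ≡ ∑[ x ∈ xs ] 𝟙 (P? x)
  length-filter≡∑𝟙 P? []       = refl
  length-filter≡∑𝟙 P? (x ∷ xs) with P? x
  ... | yes _ = cong ℕ.suc (length-filter≡∑𝟙 P? xs)
  ... | no  _ = length-filter≡∑𝟙 P? xs

  ∑-const-1 : ∀ {A : Set} (xs : List A) → ∑[ x ∈ xs ] 1 ≡ length xs
  ∑-const-1 []       = refl
  ∑-const-1 (x ∷ xs) = cong ℕ.suc (∑-const-1 xs)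

  module _ {k N : ℕ} (f : Fin k → Fin N) where

    preimage≡∑𝟙 : ∀ w → preimage f w ≡ ∑[ u ∈ allFin k ] 𝟙 (f u Fin.≟ w)
    preimage≡∑𝟙 w = length-filter≡∑𝟙 (λ u → f u Fin.≟ w) (allFin k)

    ∑-preimage : ∑[ w ∈ allFin N ] preimage f w ≡ k
    ∑-preimage = begin
      ∑[ w ∈ allFin N ] preimage f w                        ≡⟨ ∑-cong (allFin N) preimage≡∑𝟙 ⟩
      ∑[ w ∈ allFin N ] ∑[ u ∈ allFin k ] 𝟙 (f u Fin.≟ w)   ≡⟨ ∑-comm (allFin N) (allFin k) _ ⟩
      ∑[ u ∈ allFin k ] ∑[ w ∈ allFin N ] 𝟙 (f u Fin.≟ w)   ≡⟨ ∑-cong (allFin k) (λ u → ∑-𝟙-≟ N (f u)) ⟩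
      ∑[ u ∈ allFin k ] 1                                   ≡⟨ ∑-const-1 (allFin k) ⟩
      length (allFin k)                                     ≡⟨ List.length-tabulate _ ⟩
      k                                                     ∎
      where open ≡-Reasoning

    preimage-image>0 : ∀ u → 0 < preimage f (f u)
    preimage-image>0 u = List.filter-some (λ v → f v Fin.≟ f u) (Any.map (λ u≡v → cong f (sym u≡v)) (∈-allFin u))

  ∑-mono-≤ : ∀ {A : Set} (xs : List A) {f g : A → ℕ} → (∀ x → f x ≤ g x) → ∑ xs f ≤ ∑ xs g
  ∑-mono-≤ []       f≤g = z≤n
  ∑-mono-≤ (x ∷ xs) f≤g = ℕ.+-mono-≤ (f≤g x) (∑-mono-≤ xs f≤g)

  three-terms≤∑ : ∀ {n} (g : Fin n → ℕ) {x y z} → x ≢ y → x ≢ z → y ≢ z →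
                  g x + g y + g z ≤ ∑[ w ∈ allFin n ] g w
  three-terms≤∑ {n} g {x} {y} {z} x≢y x≢z y≢z = begin
    g x + g y + g z
      ≡⟨ sym (cong₂ _+_ (cong₂ _+_ (∑-δ n x g) (∑-δ n y g)) (∑-δ n z g)) ⟩
    ∑[ w ∈ allFin n ] (𝟙 (x Fin.≟ w) * g w) + ∑[ w ∈ allFin n ] (𝟙 (y Fin.≟ w) * g w) + ∑[ w ∈ allFin n ] (𝟙 (z Fin.≟ w) * g w)
      ≡⟨ sym (trans (∑-distrib-+ (allFin n) _ _) (cong (_+ _) (∑-distrib-+ (allFin n) _ _))) ⟩
    ∑[ w ∈ allFin n ] (𝟙 (x Fin.≟ w) * g w + 𝟙 (y Fin.≟ w) * g w + 𝟙 (z Fin.≟ w) * g w)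
      ≤⟨ ∑-mono-≤ (allFin n) at-most-one ⟩
    ∑[ w ∈ allFin n ] g w
      ∎
    where
    open ℕ.≤-Reasoning
    at-most-one : ∀ w → 𝟙 (x Fin.≟ w) * g w + 𝟙 (y Fin.≟ w) * g w + 𝟙 (z Fin.≟ w) * g w ≤ g w
    at-most-one w with x Fin.≟ w | y Fin.≟ w | z Fin.≟ w
    ... | yes refl | yes refl | _        = contradiction refl x≢y
    ... | yes refl | _        | yes refl = contradiction refl x≢z
    ... | _        | yes refl | yes refl = contradiction refl y≢z
    ... | yes refl | no _     | no _     = ℕ.≤-reflexive (trans (ℕ.+-identityʳ _) (trans (ℕ.+-identityʳ _) (ℕ.+-identityʳ _)))
    ... | no _     | yes refl | no _     = ℕ.≤-reflexive (trans (ℕ.+-identityʳ _) (ℕ.+-identityʳ _))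
    ... | no _     | no _     | yes refl = ℕ.≤-reflexive (ℕ.+-identityʳ _)
    ... | no _     | no _     | no _     = z≤n

  module _ {k N : ℕ} (f : Fin k → Fin N) {x y : Fin N} (x≢y : x ≢ y) where

    image⊆pair : preimage f x + preimage f y ≡ k → ∀ u → f u ≡ x ⊎ f u ≡ y
    image⊆pair fill u with f u Fin.≟ x | f u Fin.≟ y
    ... | yes fu≡x | _        = inj₁ fu≡x
    ... | no _     | yes fu≡y = inj₂ fu≡y
    ... | no fu≢x  | no fu≢y  = contradiction too-many (ℕ.<-irrefl refl)
      where
      too-many : k < k
      too-many = begin-strict
        k                                                       ≡⟨ sym fill ⟩
        preimage f x + preimage f y                             <⟨ ℕ.m<m+n _ (preimage-image>0 f u) ⟩
        preimage f x + preimage f y + preimage f (f u)          ≤⟨ three-terms≤∑ (preimage f) x≢y (fu≢x ∘ sym) (fu≢y ∘ sym) ⟩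
        ∑[ w ∈ allFin N ] preimage f w                          ≡⟨ ∑-preimage f ⟩
        k                                                       ∎
        where open ℕ.≤-Reasoning

  pairMap : ∀ {N} → Fin N → Fin N → Fin 2 → Fin N
  pairMap x y zero    = x
  pairMap x y (suc _) = y

  Extensional : ∀ {k N} → ((Fin k → Fin N) → ℕ) → Set
  Extensional F = ∀ {f g} → (∀ u → f u ≡ g u) → F f ≡ F g

  ∑-allFuns-suc : ∀ k N (F : (Fin (ℕ.suc k) → Fin N) → ℕ) →
                  ∑ (allFuns (ℕ.suc k) N) F ≡ ∑[ f ∈ allFuns k N ] ∑[ w ∈ allFin N ] F (w ∷ᶠ f)
  ∑-allFuns-suc k N F = trans (∑-concatMap _ (allFuns k N) F) (∑-cong (allFuns k N) (λ f → ∑-map _ (allFin N) F))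

  ∑-allFuns-pair : ∀ {N} {x y : Fin N} → x ≢ y → ∀ k (F : (Fin k → Fin N) → ℕ) → Extensional F →
                   (∀ f u → f u ≢ x → f u ≢ y → F f ≡ 0) →
                   ∑ (allFuns k N) F ≡ ∑[ g ∈ allFuns k 2 ] F (pairMap x y ∘ g)
  ∑-allFuns-pair x≢y ℕ.zero F ext vanish = cong (_+ 0) (ext (λ ()))
  ∑-allFuns-pair {N} {x} {y} x≢y (ℕ.suc k) F ext vanish = begin
    ∑ (allFuns (ℕ.suc k) N) F                                               ≡⟨ ∑-allFuns-suc k N F ⟩
    ∑[ f ∈ allFuns k N ] ∑[ w ∈ allFin N ] F (w ∷ᶠ f)                       ≡⟨ ∑-cong (allFuns k N) first-value-in-pair ⟩
    ∑[ f ∈ allFuns k N ] (F (x ∷ᶠ f) + F (y ∷ᶠ f))                          ≡⟨ ∑-distrib-+ (allFuns k N) _ _ ⟩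
    ∑[ f ∈ allFuns k N ] F (x ∷ᶠ f) + ∑[ f ∈ allFuns k N ] F (y ∷ᶠ f)        ≡⟨ cong₂ _+_ (restrict x) (restrict y) ⟩
    ∑[ g ∈ allFuns k 2 ] F (x ∷ᶠ (pairMap x y ∘ g)) + ∑[ g ∈ allFuns k 2 ] F (y ∷ᶠ (pairMap x y ∘ g))
                                                                            ≡⟨ sym (∑-distrib-+ (allFuns k 2) _ _) ⟩
    ∑[ g ∈ allFuns k 2 ] (F (x ∷ᶠ (pairMap x y ∘ g)) + F (y ∷ᶠ (pairMap x y ∘ g)))
                                                                            ≡⟨ ∑-cong (allFuns k 2) (λ g → cong₂ _+_ (∷-pairMap zero g)
                                                                                 (trans (∷-pairMap (suc zero) g) (sym (ℕ.+-identityʳ _)))) ⟩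
    ∑[ g ∈ allFuns k 2 ] ∑[ i ∈ allFin 2 ] F (pairMap x y ∘ (i ∷ᶠ g))       ≡⟨ sym (∑-allFuns-suc k 2 _) ⟩
    ∑[ g ∈ allFuns (ℕ.suc k) 2 ] F (pairMap x y ∘ g)                        ∎
    where
    open ≡-Reasoning
    first-value-in-pair : ∀ f → ∑[ w ∈ allFin N ] F (w ∷ᶠ f) ≡ F (x ∷ᶠ f) + F (y ∷ᶠ f)
    first-value-in-pair f = ∑-supported-on-pair N (λ w → F (w ∷ᶠ f)) x≢y (λ w → vanish (w ∷ᶠ f) zero)
    ∷-pairMap : ∀ i g → F (pairMap x y i ∷ᶠ (pairMap x y ∘ g)) ≡ F (pairMap x y ∘ (i ∷ᶠ g))
    ∷-pairMap i g = ext (λ { zero → refl ; (suc u) → refl })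
    restrict : ∀ w → ∑[ f ∈ allFuns k N ] F (w ∷ᶠ f) ≡ ∑[ g ∈ allFuns k 2 ] F (w ∷ᶠ (pairMap x y ∘ g))
    restrict w = ∑-allFuns-pair x≢y k (λ f → F (w ∷ᶠ f)) (λ f≗g → ext (λ { zero → refl ; (suc u) → f≗g u }))
                                (λ f u → vanish (w ∷ᶠ f) (suc u))

  and-true⁻ : ∀ bs → and bs ≡ true → All (_≡ true) bs
  and-true⁻ []           _   = []
  and-true⁻ (true ∷ bs)  all = refl ∷ and-true⁻ bs all

  module _ (G : Graph) where

    isHom-cong : ∀ {H H'} {f : Fin (size G) → Fin (size H)} {f' : Fin (size G) → Fin (size H')} →
                 (∀ u v → adj G u v ≡ true → adj H (f u) (f v) ≡ adj H' (f' u) (f' v)) →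
                 isHom G H f ≡ isHom G H' f'
    isHom-cong {H} {H'} {f} {f'} same =
      cong and (List.concatMap-cong (λ u → List.map-cong (edge-test u) (allFin _)) (allFin _))
      where
      edge-test : ∀ u v → not (adj G u v) ∨ adj H (f u) (f v) ≡ not (adj G u v) ∨ adj H' (f' u) (f' v)
      edge-test u v with adj G u v in uv
      ... | true  = same u v uv
      ... | false = refl

    isHom-sound : ∀ H (f : Fin (size G) → Fin (size H)) → isHom G H f ≡ true →
                  ∀ u v → adj G u v ≡ true → adj H (f u) (f v) ≡ true
    isHom-sound H f hom u v uv = subst (λ b → not b ∨ adj H (f u) (f v) ≡ true) uv edge-test
      where
      row : All (_≡ true) (map (λ v → not (adj G u v) ∨ adj H (f u) (f v)) (allFin (size G)))
      row = All.lookup (map⁻ (concat⁻ (and-true⁻ _ hom))) (∈-allFin u)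
      edge-test : not (adj G u v) ∨ adj H (f u) (f v) ≡ true
      edge-test = All.lookup (map⁻ row) (∈-allFin v)

  twoVertexAdj : (loop₀ edge loop₁ : Bool) → Fin 2 → Fin 2 → Bool
  twoVertexAdj p e q zero    zero    = p
  twoVertexAdj p e q zero    (suc _) = e
  twoVertexAdj p e q (suc _) zero    = e
  twoVertexAdj p e q (suc _) (suc _) = q

  twoVertex : (loop₀ edge loop₁ : Bool) → Graph
  twoVertex p e q = record { size = 2 ; adj = twoVertexAdj p e q ; sym = symmetric }
    where
    symmetric : ∀ i j → twoVertexAdj p e q i j ≡ twoVertexAdj p e q j i
    symmetric zero    zero    = refl
    symmetric zero    (suc _) = refl
    symmetric (suc _) zero    = refl
    symmetric (suc _) (suc _) = refl

  inducedAdj : ∀ H (x y : Fin (size H)) i j → adj H (pairMap x y i) (pairMap x y j) ≡ twoVertexAdj (adj H x x) (adj H x y) (adj H y y) i j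
  inducedAdj H x y zero    zero    = refl
  inducedAdj H x y zero    (suc _) = refl
  inducedAdj H x y (suc _) zero    = Graph.sym H y x
  inducedAdj H x y (suc _) (suc _) = refl

  fibreTerm : (G H : Graph) (x y : Fin (size H)) (a b : ℕ) → (Fin (size G) → Fin (size H)) → ℕ
  fibreTerm G H x y a b f = 𝟙 (isHom G H f Bool.≟ true) * (𝟙 (preimage f x ℕ.≟ a) * 𝟙 (preimage f y ℕ.≟ b))

  fibreHomCount : (G H : Graph) (x y : Fin (size H)) (a b : ℕ) → ℕ
  fibreHomCount G H x y a b = ∑ (allFuns (size G) (size H)) (fibreTerm G H x y a b)

  fibreTerm-cong : ∀ G H H' {x y x' y' a b} (f : Fin (size G) → Fin (size H)) (f' : Fin (size G) → Fin (size H')) →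
                   isHom G H f ≡ isHom G H' f' → preimage f x ≡ preimage f' x' → preimage f y ≡ preimage f' y' →
                   fibreTerm G H x y a b f ≡ fibreTerm G H' x' y' a b f'
  fibreTerm-cong G H H' {a = a} {b} f f' hom≡ x≡ y≡ =
    cong₂ _*_ (cong (λ h → 𝟙 (h Bool.≟ true)) hom≡) (cong₂ _*_ (cong (λ n → 𝟙 (n ℕ.≟ a)) x≡) (cong (λ n → 𝟙 (n ℕ.≟ b)) y≡))

  preimage-cong : ∀ {k N} {f g : Fin k → Fin N} → (∀ u → f u ≡ g u) → ∀ w → preimage f w ≡ preimage g w
  preimage-cong {k} {f = f} {g} f≗g w = begin
    preimage f w                        ≡⟨ preimage≡∑𝟙 f w ⟩
    ∑[ u ∈ allFin k ] 𝟙 (f u Fin.≟ w)   ≡⟨ ∑-cong (allFin k) (λ u → cong (λ v → 𝟙 (v Fin.≟ w)) (f≗g u)) ⟩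
    ∑[ u ∈ allFin k ] 𝟙 (g u Fin.≟ w)   ≡⟨ sym (preimage≡∑𝟙 g w) ⟩
    preimage g w                        ∎
    where open ≡-Reasoning

  preimage-∘-injective : ∀ {k M N} (h : Fin M → Fin N) → (∀ {i j} → h i ≡ h j → i ≡ j) →
                         (g : Fin k → Fin M) → ∀ i → preimage (h ∘ g) (h i) ≡ preimage g i
  preimage-∘-injective {k} h h-inj g i = begin
    preimage (h ∘ g) (h i)                    ≡⟨ preimage≡∑𝟙 (h ∘ g) (h i) ⟩
    ∑[ u ∈ allFin k ] 𝟙 (h (g u) Fin.≟ h i)   ≡⟨ ∑-cong (allFin k) (λ u → 𝟙-cong (h (g u) Fin.≟ h i) (g u Fin.≟ i) h-inj (cong h)) ⟩
    ∑[ u ∈ allFin k ] 𝟙 (g u Fin.≟ i)         ≡⟨ sym (preimage≡∑𝟙 g i) ⟩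
    preimage g i                              ∎
    where open ≡-Reasoning

  pairMap-injective : ∀ {N} {x y : Fin N} → x ≢ y → ∀ {i j} → pairMap x y i ≡ pairMap x y j → i ≡ j
  pairMap-injective x≢y {zero}     {zero}     _   = refl
  pairMap-injective x≢y {zero}     {suc _}    x≡y = contradiction x≡y x≢y
  pairMap-injective x≢y {suc _}    {zero}     y≡x = contradiction (sym y≡x) x≢y
  pairMap-injective x≢y {suc zero} {suc zero} _   = refl

  fibreHomCount-twoVertex : ∀ G H {x y} → x ≢ y → ∀ {a b} → a + b ≡ size G →
                            fibreHomCount G H x y a b ≡
                            fibreHomCount G (twoVertex (adj H x x) (adj H x y) (adj H y y)) zero (suc zero) a b
  fibreHomCount-twoVertex G H {x} {y} x≢y {a} {b} a+b≡size = trans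
    (∑-allFuns-pair x≢y (size G) (fibreTerm G H x y a b) extensional vanish)
    (∑-cong (allFuns (size G) 2) (λ g → fibreTerm-cong G H K (pairMap x y ∘ g) g (induced-isHom g) (fibre g zero) (fibre g (suc zero))))
    where
    K = twoVertex (adj H x x) (adj H x y) (adj H y y)
    induced-isHom : ∀ g → isHom G H (pairMap x y ∘ g) ≡ isHom G K g
    induced-isHom g = isHom-cong G {H} {K} {pairMap x y ∘ g} {g} (λ u v _ → inducedAdj H x y (g u) (g v))
    fibre : ∀ g i → preimage (pairMap x y ∘ g) (pairMap x y i) ≡ preimage g i
    fibre = preimage-∘-injective (pairMap x y) (pairMap-injective x≢y)
    extensional : Extensional (fibreTerm G H x y a b)
    extensional {f} {f'} f≗f' = fibreTerm-cong G H H f f' (isHom-cong G {H} {H} {f} {f'} (λ u v _ → cong₂ (adj H) (f≗f' u) (f≗f' v)))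
                                                 (preimage-cong f≗f' x) (preimage-cong f≗f' y)
    vanish : ∀ f u → f u ≢ x → f u ≢ y → fibreTerm G H x y a b f ≡ 0
    vanish f u fu≢x fu≢y = trans (cong (𝟙 (isHom G H f Bool.≟ true) *_) (not-both (preimage f x ℕ.≟ a) (preimage f y ℕ.≟ b)))
                                 (ℕ.*-zeroʳ (𝟙 (isHom G H f Bool.≟ true)))
      where
      not-both : (p : Dec (preimage f x ≡ a)) (q : Dec (preimage f y ≡ b)) → 𝟙 p * 𝟙 q ≡ 0
      not-both (yes fx≡a) (yes fy≡b) = contradiction (image⊆pair f x≢y (trans (cong₂ _+_ fx≡a fy≡b) a+b≡size) u) [ fu≢x , fu≢y ]
      not-both (yes _)    (no _)     = refl
      not-both (no _)     _          = refl

  infix 4 _≟ₗ_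
  _≟ₗ_ : (xs ys : List ℕ) → Dec (xs ≡ ys)
  _≟ₗ_ = List.≡-dec _≟_

  insertDesc-↭ : ∀ x xs → insertDesc x xs ↭ x ∷ xs
  insertDesc-↭ x []       = ↭-refl
  insertDesc-↭ x (y ∷ ys) with y ≤ᵇ x
  ... | true  = ↭-refl
  ... | false = ↭-trans (prep y (insertDesc-↭ x ys)) (swap y x ↭-refl)

  sortDesc-↭ : ∀ xs → sortDesc xs ↭ xs
  sortDesc-↭ []       = ↭-refl
  sortDesc-↭ (x ∷ xs) = ↭-trans (insertDesc-↭ x (sortDesc xs)) (prep x (sortDesc-↭ xs))

  sortDesc-∉ : ∀ {c xs ys} → c ∉ xs → sortDesc xs ≢ c ∷ ys
  sortDesc-∉ {c} {xs} c∉xs sorted≡ = c∉xs (∈-resp-↭ (sortDesc-↭ xs) (subst (c ∈_) (sym sorted≡) (here refl)))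

  ∈⇒↭∷ : ∀ {c : ℕ} {xs} → c ∈ xs → ∃ λ ys → xs ↭ c ∷ ys
  ∈⇒↭∷ {c} c∈xs with ys , zs , refl ← ∈-∃++ c∈xs = ys ++ zs , shift c ys zs

  mult≡∑𝟙 : ∀ c xs → mult c xs ≡ ∑[ x ∈ xs ] 𝟙 (x ≟ c)
  mult≡∑𝟙 c = length-filter≡∑𝟙 (λ j → j ≟ c)

  mult-∷ : ∀ c x xs → mult c (x ∷ xs) ≡ 𝟙 (x ≟ c) + mult c xs
  mult-∷ c x xs = trans (mult≡∑𝟙 c (x ∷ xs)) (cong (𝟙 (x ≟ c) +_) (sym (mult≡∑𝟙 c xs)))

  mult-↭ : ∀ c {xs ys} → xs ↭ ys → mult c xs ≡ mult c ys
  mult-↭ c xs↭ys = ↭-length (filter-↭ (λ j → j ≟ c) xs↭ys)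

  mult-∉ : ∀ {c : ℕ} {xs} → c ∉ xs → mult c xs ≡ 0
  mult-∉ {c} {xs} c∉xs = cong length (List.filter-none (λ j → j ≟ c) (All.map (λ c≢x x≡c → c≢x (sym x≡c)) (¬Any⇒All¬ xs c∉xs)))

  mult-pair : ∀ c p q → mult c (p ∷ q ∷ []) ≡ 𝟙 (p ≟ c) + 𝟙 (q ≟ c)
  mult-pair c p q = trans (mult≡∑𝟙 c (p ∷ q ∷ [])) (cong (𝟙 (p ≟ c) +_) (ℕ.+-identityʳ _))

  sortDesc-pair : ∀ {a b} → b ≤ a → sortDesc (a ∷ b ∷ []) ≡ a ∷ b ∷ []
  sortDesc-pair {a} {b} b≤a with b ≤ᵇ a | ℕ.≤⇒≤ᵇ b≤a
  ... | true | _ = refl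

  sortDesc-pair-swap : ∀ {a b} → b < a → sortDesc (b ∷ a ∷ []) ≡ a ∷ b ∷ []
  sortDesc-pair-swap {a} {b} b<a with a ≤ᵇ b | ℕ.≤ᵇ⇒≤ a b
  ... | true  | a≤b = contradiction (a≤b _) (ℕ.<⇒≱ b<a)
  ... | false | _   = refl

  parts≤sum : ∀ xs → All (_≤ sum xs) xs
  parts≤sum []       = []
  parts≤sum (x ∷ xs) = ℕ.m≤m+n x (sum xs) ∷ All.map (λ y≤ → ℕ.≤-trans y≤ (ℕ.m≤n+m (sum xs) x)) (parts≤sum xs)

  parts<sum : ∀ xs → All (1 ≤_) xs → length xs ≢ 1 → All (_< sum xs) xs
  parts<sum []                 _                 _      = []
  parts<sum (_ ∷ [])           _                 len≢1 = contradiction refl len≢1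
  parts<sum (p ∷ q ∷ zs)       (1≤p ∷ 1≤q ∷ _)   _     =
    p<sum ∷ q<sum ∷ All.map (λ z≤ → ℕ.<-≤-trans (ℕ.≤-<-trans z≤ (ℕ.m<n+m _ 1≤q)) (ℕ.m≤n+m _ p)) (parts≤sum zs)
    where
    p<sum : p < p + (q + sum zs)
    p<sum = ℕ.m<m+n p (ℕ.<-≤-trans 1≤q (ℕ.m≤m+n q _))
    q<sum : q < p + (q + sum zs)
    q<sum = ℕ.<-≤-trans (ℕ.m<n+m q 1≤p) (ℕ.+-monoʳ-≤ p (ℕ.m≤m+n q _))

  All-<⇒∉ : ∀ {c : ℕ} {xs} → All (_< c) xs → c ∉ xs
  All-<⇒∉ (x<c ∷ _)    (here refl)  = ℕ.<-irrefl refl x<c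
  All-<⇒∉ (_   ∷ xs<c) (there c∈xs) = All-<⇒∉ xs<c c∈xs

  -- mult a xs * mult b xs counts pairs of positions holding a and b.  Two distinct such
  -- positions already account for sum xs = a + b, so they occur only when xs is a
  -- permutation of [a, b]; the pairs on the diagonal contribute 𝟙 (a ≟ b) * mult a xs.
  module MultProduct {a b : ℕ} where

    private
      e = 𝟙 (a ≟ b)

    Holds : List ℕ → Set
    Holds xs = mult a xs * mult b xs ≡ (1 + e) * 𝟙 (sortDesc xs ≟ₗ a ∷ b ∷ []) + e * mult a xs

    sorted : b ≤ a → Holds (a ∷ b ∷ [])
    sorted b≤a = begin
      mult a (a ∷ b ∷ []) * mult b (a ∷ b ∷ [])      ≡⟨ cong₂ _*_ mult-a mult-b ⟩
      (1 + e) * (e + 1)                              ≡⟨ square e ⟩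
      (1 + e) * 1 + e * (1 + e)                      ≡⟨ cong₂ (λ s t → (1 + e) * s + e * t) (sym is-sorted) (sym mult-a) ⟩
      (1 + e) * 𝟙 (sortDesc (a ∷ b ∷ []) ≟ₗ a ∷ b ∷ []) + e * mult a (a ∷ b ∷ []) ∎
      where
      open ≡-Reasoning
      open ℕ-Solver.+-*-Solver
      square : ∀ e → (1 + e) * (e + 1) ≡ (1 + e) * 1 + e * (1 + e)
      square = solve 1 (λ e → (con 1 :+ e) :* (e :+ con 1) := (con 1 :+ e) :* con 1 :+ e :* (con 1 :+ e)) refl
      mult-a : mult a (a ∷ b ∷ []) ≡ 1 + e
      mult-a = trans (mult-pair a a b) (cong₂ _+_ (𝟙-yes (a ≟ a) refl) (𝟙-cong (b ≟ a) (a ≟ b) sym sym))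
      mult-b : mult b (a ∷ b ∷ []) ≡ e + 1
      mult-b = trans (mult-pair b a b) (cong (e +_) (𝟙-yes (b ≟ b) refl))
      is-sorted : 𝟙 (sortDesc (a ∷ b ∷ []) ≟ₗ a ∷ b ∷ []) ≡ 1
      is-sorted = 𝟙-yes (sortDesc (a ∷ b ∷ []) ≟ₗ a ∷ b ∷ []) (sortDesc-pair b≤a)

    transfer : ∀ {xs ys} → (∀ c → mult c xs ≡ mult c ys) → sortDesc xs ≡ sortDesc ys → Holds ys → Holds xs
    transfer {xs} {ys} same-mult same-sort holds = begin
      mult a xs * mult b xs                                   ≡⟨ cong₂ _*_ (same-mult a) (same-mult b) ⟩
      mult a ys * mult b ys                                   ≡⟨ holds ⟩
      (1 + e) * 𝟙 (sortDesc ys ≟ₗ a ∷ b ∷ []) + e * mult a ys ≡⟨ cong₂ (λ s m → (1 + e) * 𝟙 (s ≟ₗ a ∷ b ∷ []) + e * m) (sym same-sort) (sym (same-mult a)) ⟩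
      (1 + e) * 𝟙 (sortDesc xs ≟ₗ a ∷ b ∷ []) + e * mult a xs ∎
      where open ≡-Reasoning

    absent : ∀ {xs} → a ∉ xs → Holds xs
    absent {xs} a∉xs = begin
      mult a xs * mult b xs                                   ≡⟨ cong (_* mult b xs) (mult-∉ a∉xs) ⟩
      0                                                       ≡⟨ sym (cong₂ _+_ (ℕ.*-zeroʳ (1 + e)) (ℕ.*-zeroʳ e)) ⟩
      (1 + e) * 0 + e * 0                                     ≡⟨ sym (cong₂ (λ s m → (1 + e) * s + e * m) (𝟙-no (sortDesc xs ≟ₗ a ∷ b ∷ []) (sortDesc-∉ a∉xs)) (mult-∉ a∉xs)) ⟩
      (1 + e) * 𝟙 (sortDesc xs ≟ₗ a ∷ b ∷ []) + e * mult a xs ∎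
      where open ≡-Reasoning

    pair : ∀ p q → sum (p ∷ q ∷ []) ≡ a + b → b ≤ a → Holds (p ∷ q ∷ [])
    pair p q p+q≡a+b b≤a with p ≟ a | p ≟ b
    ... | yes refl | _ rewrite ℕ.+-cancelˡ-≡ a q b (trans (cong (a +_) (sym (ℕ.+-identityʳ q))) p+q≡a+b) = sorted b≤a
    ... | no p≢a | yes refl rewrite ℕ.+-cancelˡ-≡ b q a (trans (cong (b +_) (sym (ℕ.+-identityʳ q))) (trans p+q≡a+b (ℕ.+-comm a b))) =
      transfer {b ∷ a ∷ []} {a ∷ b ∷ []} swap-mult (trans (sortDesc-pair-swap b<a) (sym (sortDesc-pair b≤a))) (sorted b≤a)
      where
      b<a : b < a
      b<a = ℕ.≤∧≢⇒< b≤a p≢a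
      swap-mult : ∀ c → mult c (b ∷ a ∷ []) ≡ mult c (a ∷ b ∷ [])
      swap-mult c = trans (mult-pair c b a) (trans (ℕ.+-comm (𝟙 (b ≟ c)) _) (sym (mult-pair c a b)))
    ... | no p≢a | no p≢b = absent {p ∷ q ∷ []} a∉pq
      where
      a∉pq : a ∉ p ∷ q ∷ []
      a∉pq (here a≡p)         = p≢a (sym a≡p)
      a∉pq (there (here a≡q)) = p≢b (ℕ.+-cancelʳ-≡ a p b (begin
        p + a         ≡⟨ cong (λ z → p + z) (trans (sym (ℕ.+-identityʳ a)) (cong (_+ 0) a≡q)) ⟩
        p + (q + 0)   ≡⟨ p+q≡a+b ⟩
        a + b         ≡⟨ ℕ.+-comm a b ⟩
        b + a         ∎))
        where open ≡-Reasoning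

    other-length : ∀ xs → length xs ≢ 2 → All (1 ≤_) xs → sum xs ≡ a + b → b ≤ a → Holds xs
    other-length xs len≢2 pos sum≡a+b b≤a with a ∈? xs
    ... | no a∉xs = absent a∉xs
    ... | yes a∈xs with ys , xs↭a∷ys ← ∈⇒↭∷ a∈xs = begin
      mult a xs * mult b xs                                   ≡⟨ cong₂ _*_ a-once b-count ⟩
      1 * e                                                   ≡⟨ ℕ.*-identityˡ e ⟩
      e                                                       ≡⟨ sym (cong₂ _+_ (ℕ.*-zeroʳ (1 + e)) (ℕ.*-identityʳ e)) ⟩
      (1 + e) * 0 + e * 1                                     ≡⟨ sym (cong₂ (λ s m → (1 + e) * s + e * m) unsorted a-once) ⟩
      (1 + e) * 𝟙 (sortDesc xs ≟ₗ a ∷ b ∷ []) + e * mult a xs ∎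
      where
      open ≡-Reasoning
      sum-ys : sum ys ≡ b
      sum-ys = ℕ.+-cancelˡ-≡ a _ _ (trans (sym (sum-↭ xs↭a∷ys)) sum≡a+b)
      ys<b : All (_< b) ys
      ys<b with _ ∷ pos-ys ← All-resp-↭ xs↭a∷ys pos =
        subst (λ s → All (_< s) ys) sum-ys (parts<sum ys pos-ys (λ len≡1 → len≢2 (trans (↭-length xs↭a∷ys) (cong ℕ.suc len≡1))))
      a-once : mult a xs ≡ 1
      a-once = trans (mult-↭ a xs↭a∷ys) (trans (mult-∷ a a ys)
                 (cong₂ _+_ (𝟙-yes (a ≟ a) refl) (mult-∉ (All-<⇒∉ (All.map (λ y<b → ℕ.<-≤-trans y<b b≤a) ys<b)))))
      b-count : mult b xs ≡ e
      b-count = trans (mult-↭ b xs↭a∷ys) (trans (mult-∷ b a ys) (trans (cong (e +_) (mult-∉ (All-<⇒∉ ys<b))) (ℕ.+-identityʳ e)))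
      unsorted : 𝟙 (sortDesc xs ≟ₗ a ∷ b ∷ []) ≡ 0
      unsorted = 𝟙-no (sortDesc xs ≟ₗ a ∷ b ∷ []) (λ sorted≡ → len≢2 (trans (sym (↭-length (sortDesc-↭ xs))) (cong length sorted≡)))

    holds : ∀ xs → All (1 ≤_) xs → sum xs ≡ a + b → b ≤ a → Holds xs
    holds []               = other-length [] (λ ())
    holds (p ∷ [])         = other-length (p ∷ []) (λ ())
    holds (p ∷ q ∷ [])   _ = pair p q
    holds xs@(_ ∷ _ ∷ _ ∷ _) = other-length xs (λ ())

  mult-product : ∀ {a b} xs → All (1 ≤_) xs → sum xs ≡ a + b → b ≤ a →
                 mult a xs * mult b xs ≡ (1 + 𝟙 (a ≟ b)) * 𝟙 (sortDesc xs ≟ₗ a ∷ b ∷ []) + 𝟙 (a ≟ b) * mult a xs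
  mult-product = MultProduct.holds

  preimageSizes : ∀ {k N} → (Fin k → Fin N) → List ℕ
  preimageSizes {N = N} f = filter (1 ℕ.≤?_) (map (preimage f) (allFin N))

  sum≡∑ : ∀ xs → sum xs ≡ ∑[ x ∈ xs ] x
  sum≡∑ []       = refl
  sum≡∑ (x ∷ xs) = cong (x +_) (sum≡∑ xs)

  module _ {k N} (f : Fin k → Fin N) where

    sum-preimageSizes : sum (preimageSizes f) ≡ k
    sum-preimageSizes = begin
      sum (preimageSizes f)                                    ≡⟨ sum≡∑ (preimageSizes f) ⟩
      ∑[ s ∈ preimageSizes f ] s                               ≡⟨ ∑-filter (1 ℕ.≤?_) (map (preimage f) (allFin N)) (λ s → s) ⟩
      ∑[ s ∈ map (preimage f) (allFin N) ] (𝟙 (1 ℕ.≤? s) * s)  ≡⟨ ∑-cong (map (preimage f) (allFin N)) drop-zero ⟩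
      ∑[ s ∈ map (preimage f) (allFin N) ] s                   ≡⟨ ∑-map (preimage f) (allFin N) (λ s → s) ⟩
      ∑[ w ∈ allFin N ] preimage f w                           ≡⟨ ∑-preimage f ⟩
      k                                                        ∎
      where
      open ≡-Reasoning
      drop-zero : ∀ s → 𝟙 (1 ℕ.≤? s) * s ≡ s
      drop-zero ℕ.zero    = refl
      drop-zero (ℕ.suc s) = ℕ.*-identityˡ (ℕ.suc s)

    mult-preimageSizes : ∀ {c} → 1 ≤ c → mult c (preimageSizes f) ≡ ∑[ w ∈ allFin N ] 𝟙 (preimage f w ≟ c)
    mult-preimageSizes {c} 1≤c = begin
      mult c (preimageSizes f)                                             ≡⟨ mult≡∑𝟙 c (preimageSizes f) ⟩
      ∑[ s ∈ preimageSizes f ] 𝟙 (s ≟ c)                                   ≡⟨ ∑-filter (1 ℕ.≤?_) (map (preimage f) (allFin N)) (λ s → 𝟙 (s ≟ c)) ⟩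
      ∑[ s ∈ map (preimage f) (allFin N) ] (𝟙 (1 ℕ.≤? s) * 𝟙 (s ≟ c))      ≡⟨ ∑-cong (map (preimage f) (allFin N)) (λ s → positive (s ≟ c)) ⟩
      ∑[ s ∈ map (preimage f) (allFin N) ] 𝟙 (s ≟ c)                       ≡⟨ ∑-map (preimage f) (allFin N) (λ s → 𝟙 (s ≟ c)) ⟩
      ∑[ w ∈ allFin N ] 𝟙 (preimage f w ≟ c)                               ∎
      where
      open ≡-Reasoning
      positive : ∀ {s} (s≟c : Dec (s ≡ c)) → 𝟙 (1 ℕ.≤? s) * 𝟙 s≟c ≡ 𝟙 s≟c
      positive {s} (yes refl) = cong (_* 1) (𝟙-yes (1 ℕ.≤? s) 1≤c)
      positive {s} (no _)     = ℕ.*-zeroʳ (𝟙 (1 ℕ.≤? s))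

  𝟙-≟-both : ∀ (v a b : ℕ) → 𝟙 (v ≟ a) * 𝟙 (v ≟ b) ≡ 𝟙 (a ≟ b) * 𝟙 (v ≟ a)
  𝟙-≟-both v a b = both (v ≟ a) (v ≟ b) (a ≟ b)
    where
    both : (p : Dec (v ≡ a)) (q : Dec (v ≡ b)) (r : Dec (a ≡ b)) → 𝟙 p * 𝟙 q ≡ 𝟙 r * 𝟙 p
    both (yes _)    (yes _)    (yes _)   = refl
    both (yes refl) (yes refl) (no a≢b)  = contradiction refl a≢b
    both (yes refl) (no v≢b)   (yes a≡b) = contradiction a≡b v≢b
    both (yes _)    (no _)     (no _)    = refl
    both (no _)     _          r         = sym (ℕ.*-zeroʳ (𝟙 r))

  typeOf-indicator : ∀ {k N} (f : Fin k → Fin N) {a b} → a + b ≡ k → 1 ≤ b → b ≤ a →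
    (1 + 𝟙 (a ≟ b)) * 𝟙 (typeOf f ≟ₗ a ∷ b ∷ []) ≡
    ∑[ x ∈ allFin N ] ∑[ y ∈ allFin N ] (𝟙 (¬? (x Fin.≟ y)) * (𝟙 (preimage f x ≟ a) * 𝟙 (preimage f y ≟ b)))
  typeOf-indicator {k} {N} f {a} {b} a+b≡k 1≤b b≤a = ℕ.+-cancelʳ-≡ (e * fibres a) _ _ (begin
    (1 + e) * 𝟙 (typeOf f ≟ₗ a ∷ b ∷ []) + e * fibres a
      ≡⟨ cong (λ m → (1 + e) * 𝟙 (typeOf f ≟ₗ a ∷ b ∷ []) + e * m) (sym (mult-preimageSizes f 1≤a)) ⟩
    (1 + e) * 𝟙 (typeOf f ≟ₗ a ∷ b ∷ []) + e * mult a (preimageSizes f)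
      ≡⟨ sym (mult-product (preimageSizes f) (all-filter (1 ℕ.≤?_) (map (preimage f) (allFin N))) (trans (sum-preimageSizes f) (sym a+b≡k)) b≤a) ⟩
    mult a (preimageSizes f) * mult b (preimageSizes f)
      ≡⟨ cong₂ _*_ (mult-preimageSizes f 1≤a) (mult-preimageSizes f 1≤b) ⟩
    fibres a * fibres b
      ≡⟨ ∑-product-split-diagonal N _ _ ⟩
    off-diagonal + ∑[ x ∈ allFin N ] (𝟙 (preimage f x ≟ a) * 𝟙 (preimage f x ≟ b))
      ≡⟨ cong (off-diagonal +_) (trans (∑-cong (allFin N) (λ x → 𝟙-≟-both (preimage f x) a b)) (sym (*-distribˡ-∑ (allFin N) e _))) ⟩
    off-diagonal + e * fibres a
      ∎)
    where
    open ≡-Reasoning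
    e = 𝟙 (a ≟ b)
    1≤a = ℕ.≤-trans 1≤b b≤a
    fibres : ℕ → ℕ
    fibres c = ∑[ x ∈ allFin N ] 𝟙 (preimage f x ≟ c)
    off-diagonal = ∑[ x ∈ allFin N ] ∑[ y ∈ allFin N ] (𝟙 (¬? (x Fin.≟ y)) * (𝟙 (preimage f x ≟ a) * 𝟙 (preimage f y ≟ b)))

  module _ (G H : Graph) where

    private
      Maps = allFuns (size G) (size H)
      Vertices = allFin (size H)
      hom : (Fin (size G) → Fin (size H)) → ℕ
      hom f = 𝟙 (isHom G H f Bool.≟ true)

    homCount≡∑ : ∀ μ → homCount G H μ ≡ ∑[ f ∈ Maps ] (hom f * 𝟙 (typeOf f ≟ₗ proj₁ μ))
    homCount≡∑ (μ , _) = trans (length-filter≡∑𝟙 (λ f → typeOf f ≟ₗ μ) (filter (λ f → isHom G H f Bool.≟ true) Maps))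
                               (∑-filter (λ f → isHom G H f Bool.≟ true) Maps (λ f → 𝟙 (typeOf f ≟ₗ μ)))

    homCount-of-wrong-size : ∀ μ → ∣ μ ∣ₚ ≢ size G → homCount G H μ ≡ 0
    homCount-of-wrong-size μ ∣μ∣≢size = trans (homCount≡∑ μ) (∑-zero Maps (λ f → trans (cong (hom f *_) (not-type f)) (ℕ.*-zeroʳ (hom f))))
      where
      not-type : ∀ f → 𝟙 (typeOf f ≟ₗ proj₁ μ) ≡ 0
      not-type f = 𝟙-no (typeOf f ≟ₗ proj₁ μ) (λ type≡μ → ∣μ∣≢size (begin
        sum (proj₁ μ)          ≡⟨ cong sum (sym type≡μ) ⟩
        sum (typeOf f)         ≡⟨ sum-↭ (sortDesc-↭ (preimageSizes f)) ⟩
        sum (preimageSizes f)  ≡⟨ sum-preimageSizes f ⟩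
        size G                 ∎))
        where open ≡-Reasoning

    homCount-two-parts-fibres : ∀ {a b} (pf : IsPartition (a ∷ b ∷ [])) → a + b ≡ size G → 1 ≤ b → b ≤ a →
      (1 + 𝟙 (a ≟ b)) * homCount G H ((a ∷ b ∷ []) , pf) ≡
      ∑[ x ∈ Vertices ] ∑[ y ∈ Vertices ] (𝟙 (¬? (x Fin.≟ y)) * fibreHomCount G H x y a b)
    homCount-two-parts-fibres {a} {b} pf a+b≡size 1≤b b≤a = begin
      (1 + e) * homCount G H ((a ∷ b ∷ []) , pf)
        ≡⟨ cong ((1 + e) *_) (homCount≡∑ ((a ∷ b ∷ []) , pf)) ⟩
      (1 + e) * ∑[ f ∈ Maps ] (hom f * type f)
        ≡⟨ *-distribˡ-∑ Maps (1 + e) _ ⟩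
      ∑[ f ∈ Maps ] ((1 + e) * (hom f * type f))
        ≡⟨ ∑-cong Maps (λ f → trans (x∙yz≈y∙xz (1 + e) (hom f) (type f)) (cong (hom f *_) (typeOf-indicator f a+b≡size 1≤b b≤a))) ⟩
      ∑[ f ∈ Maps ] (hom f * ∑[ x ∈ Vertices ] ∑[ y ∈ Vertices ] (off x y * fibres f x y))
        ≡⟨ ∑-cong Maps (λ f → trans (*-distribˡ-∑ Vertices (hom f) _) (∑-cong Vertices (λ x → trans (*-distribˡ-∑ Vertices (hom f) _)
                                    (∑-cong Vertices (λ y → x∙yz≈y∙xz (hom f) (off x y) (fibres f x y)))))) ⟩
      ∑[ f ∈ Maps ] ∑[ x ∈ Vertices ] ∑[ y ∈ Vertices ] (off x y * (hom f * fibres f x y))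
        ≡⟨ trans (∑-comm Maps Vertices _) (∑-cong Vertices (λ x → ∑-comm Maps Vertices _)) ⟩
      ∑[ x ∈ Vertices ] ∑[ y ∈ Vertices ] ∑[ f ∈ Maps ] (off x y * (hom f * fibres f x y))
        ≡⟨ ∑-cong Vertices (λ x → ∑-cong Vertices (λ y → sym (*-distribˡ-∑ Maps (off x y) _))) ⟩
      ∑[ x ∈ Vertices ] ∑[ y ∈ Vertices ] (off x y * fibreHomCount G H x y a b)
        ∎
      where
      open ≡-Reasoning
      e = 𝟙 (a ≟ b)
      type : (Fin (size G) → Fin (size H)) → ℕ
      type f = 𝟙 (typeOf f ≟ₗ a ∷ b ∷ [])
      off : Fin (size H) → Fin (size H) → ℕ
      off x y = 𝟙 (¬? (x Fin.≟ y))
      fibres : (Fin (size G) → Fin (size H)) → Fin (size H) → Fin (size H) → ℕ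
      fibres f x y = 𝟙 (preimage f x ≟ a) * 𝟙 (preimage f y ≟ b)

  twoVertexCount : Graph → (a b : ℕ) → (loop₀ edge loop₁ : Bool) → ℕ
  twoVertexCount G a b p e q = fibreHomCount G (twoVertex p e q) zero (suc zero) a b

  homCount-two-parts : ∀ G H {a b} (pf : IsPartition (a ∷ b ∷ [])) → a + b ≡ size G → 1 ≤ b → b ≤ a →
    (1 + 𝟙 (a ≟ b)) * homCount G H ((a ∷ b ∷ []) , pf) ≡
    ∑[ x ∈ allFin (size H) ] ∑[ y ∈ allFin (size H) ] (𝟙 (¬? (x Fin.≟ y)) * twoVertexCount G a b (adj H x x) (adj H x y) (adj H y y))
  homCount-two-parts G H pf a+b≡size 1≤b b≤a =
    trans (homCount-two-parts-fibres G H pf a+b≡size 1≤b b≤a)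
          (∑-cong (allFin (size H)) (λ x → ∑-cong (allFin (size H)) (λ y → local x y (x Fin.≟ y))))
    where
    local : ∀ x y (x≟y : Dec (x ≡ y)) →
            𝟙 (¬? x≟y) * fibreHomCount G H x y _ _ ≡ 𝟙 (¬? x≟y) * twoVertexCount G _ _ (adj H x x) (adj H x y) (adj H y y)
    local x y (yes _)   = refl
    local x y (no x≢y)  = cong (1 *_) (fibreHomCount-twoVertex G H x≢y a+b≡size)

  module _ (G : Graph) where

    edgeless-or-edge : (∀ u v → adj G u v ≡ false) ⊎ ∃₂ (λ u v → adj G u v ≡ true)
    edgeless-or-edge with Fin.any? (λ u → Fin.any? (λ v → adj G u v Bool.≟ true))
    ... | yes (u , v , uv) = inj₂ (u , v , uv)
    ... | no  no-edge      = inj₁ (λ u v → Bool.¬-not (λ uv → no-edge (u , v , uv)))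

    twoVertexCount-edgeless : (∀ u v → adj G u v ≡ false) → ∀ a b {p e q p' e' q'} →
                              twoVertexCount G a b p e q ≡ twoVertexCount G a b p' e' q'
    twoVertexCount-edgeless edgeless a b {p} {e} {q} {p'} {e'} {q'} =
      ∑-cong (allFuns (size G) 2) (λ g → fibreTerm-cong G (twoVertex p e q) (twoVertex p' e' q') g g
                                          (isHom-cong G {twoVertex p e q} {twoVertex p' e' q'} {g} {g}
                                                      (λ u v uv → contradiction (trans (sym uv) (edgeless u v)) λ ()))
                                          refl refl)

    twoVertexCount-edge : ∀ {u v} → adj G u v ≡ true → ∀ a b → twoVertexCount G a b false false false ≡ 0
    twoVertexCount-edge {u} {v} uv a b = ∑-zero (allFuns (size G) 2) no-hom
      where
      K = twoVertex false false false
      no-edge : ∀ i j → twoVertexAdj false false false i j ≢ true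
      no-edge zero    zero    ()
      no-edge zero    (suc _) ()
      no-edge (suc _) zero    ()
      no-edge (suc _) (suc _) ()
      no-hom : ∀ g → fibreTerm G K zero (suc zero) a b g ≡ 0
      no-hom g = cong (_* (𝟙 (preimage g zero ≟ a) * 𝟙 (preimage g (suc zero) ≟ b)))
                      (𝟙-no (isHom G K g Bool.≟ true) (λ hom → no-edge (g u) (g v) (isHom-sound G K g hom u v uv)))

  product-applyUpTo-ones : ∀ n (h : ℕ → ℕ) → (∀ i → h i ≡ 1) → product (applyUpTo h n) ≡ 1
  product-applyUpTo-ones zero    h ones = refl
  product-applyUpTo-ones (suc n) h ones = cong₂ _*_ (ones 0) (product-applyUpTo-ones n (h ∘ suc) (ones ∘ suc))

  product-applyUpTo-single : ∀ {n i₀} (h : ℕ → ℕ) → i₀ < n → (∀ i → i ≢ i₀ → h i ≡ 1) → product (applyUpTo h n) ≡ h i₀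
  product-applyUpTo-single {suc n} {zero}   h _         ones =
    trans (cong (h 0 *_) (product-applyUpTo-ones n (h ∘ suc) (λ i → ones (suc i) λ ()))) (ℕ.*-identityʳ (h 0))
  product-applyUpTo-single {suc n} {suc i₀} h (s<s i₀<n) ones =
    trans (cong₂ _*_ (ones 0 λ ()) (product-applyUpTo-single (h ∘ suc) i₀<n (λ i i≢i₀ → ones (suc i) (i≢i₀ ∘ ℕ.suc-injective))))
          (ℕ.*-identityˡ (h (suc i₀)))

  mScalar-two-parts : ∀ N {a b} (pf : IsPartition (a ∷ b ∷ [])) → 1 ≤ b →
                      mScalar N ((a ∷ b ∷ []) , pf) ≡ (1 + 𝟙 (a ≟ b)) * (N ∸ 2) !
  mScalar-two-parts N {a} {suc b} pf _ = cong (_* (N ∸ 2) !) (begin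
    product (map h (upTo (a + (suc b + 0))))   ≡⟨ cong product (List.map-upTo h (a + (suc b + 0))) ⟩
    product (applyUpTo h (a + (suc b + 0)))    ≡⟨ product-applyUpTo-single h b<size others ⟩
    h b                                        ≡⟨ cong _! (trans (mult-pair (suc b) a (suc b)) (cong (𝟙 (a ≟ suc b) +_) (𝟙-yes (suc b ≟ suc b) refl))) ⟩
    (𝟙 (a ≟ suc b) + 1) !                       ≡⟨ twice (a ≟ suc b) ⟩
    1 + 𝟙 (a ≟ suc b)                           ∎)
    where
    open ≡-Reasoning
    h : ℕ → ℕ
    h i = mult (suc i) (a ∷ suc b ∷ []) !
    b<size : b < a + (suc b + 0)
    b<size = ℕ.<-≤-trans (ℕ.n<1+n b) (ℕ.≤-trans (ℕ.m≤m+n (suc b) 0) (ℕ.m≤n+m _ a))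
    once : ∀ {P : Set} (d : Dec P) → (𝟙 d + 0) ! ≡ 1
    once (yes _) = refl
    once (no _)  = refl
    twice : ∀ {P : Set} (d : Dec P) → (𝟙 d + 1) ! ≡ 1 + 𝟙 d
    twice (yes _) = refl
    twice (no _)  = refl
    others : ∀ i → i ≢ b → h i ≡ 1
    others i i≢b = trans (cong _! (trans (mult-pair (suc i) a (suc b))
                                         (cong (𝟙 (a ≟ suc i) +_) (𝟙-no (suc b ≟ suc i) (i≢b ∘ sym ∘ ℕ.suc-injective)))))
                         (once (a ≟ suc i))

module LinearAlgebra where

  open import Data.Rational using (ℚ; 0ℚ; 1ℚ; _+_; _*_; -_; 1/_)
  open import Data.Fin using (_≟_)
  open ≡ hiding ([_])
  open import Algebra.Properties.CommutativeSemigroup (CommutativeRing.*-commutativeSemigroup ℚ.+-*-commutativeRing) using (x∙yz≈y∙xz)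
  open Sums (CommutativeRing.commutativeSemiring ℚ.+-*-commutativeRing)

  infix 8 _·_
  _·_ : ∀ {n} → Vector ℚ n → Vector ℚ n → ℚ
  _·_ {n} u v = ∑[ k ∈ allFin n ] (u k * v k)

  module _ {n} (u : Vector ℚ n) where

    ·-cong : ∀ {v w : Vector ℚ n} → (∀ k → v k ≡ w k) → u · v ≡ u · w
    ·-cong v≗w = ∑-cong (allFin n) (λ k → cong (u k *_) (v≗w k))

    ·-distrib-+ : ∀ (v w : Vector ℚ n) → u · (λ k → v k + w k) ≡ u · v + u · w
    ·-distrib-+ v w = trans (∑-cong (allFin n) (λ k → ℚ.*-distribˡ-+ (u k) (v k) (w k))) (∑-distrib-+ (allFin n) _ _)

    ·-scale : ∀ c (v : Vector ℚ n) → u · (λ k → c * v k) ≡ c * (u · v)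
    ·-scale c v = trans (∑-cong (allFin n) (λ k → x∙yz≈y∙xz (u k) c (v k))) (sym (*-distribˡ-∑ (allFin n) c _))

    ·-zero : u · (λ _ → 0ℚ) ≡ 0ℚ
    ·-zero = ∑-zero (allFin n) (λ k → ℚ.*-zeroʳ (u k))

    ·-∑ : ∀ {A : Set} (zs : List A) (F : A → Vector ℚ n) → u · (λ k → ∑[ z ∈ zs ] F z k) ≡ ∑[ z ∈ zs ] (u · F z)
    ·-∑ zs F = trans (∑-cong (allFin n) (λ k → *-distribˡ-∑ zs (u k) (λ z → F z k))) (∑-comm (allFin n) zs _)

    ·-δ : ∀ j → u · (λ k → 𝟙 (k ≟ j)) ≡ u j
    ·-δ j = trans (∑-cong (allFin n) (λ k → trans (ℚ.*-comm (u k) _) (cong (_* u k) (𝟙-cong (k ≟ j) (j ≟ k) sym sym)))) (∑-δ n j u)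

  ·-suc : ∀ {n} (u v : Vector ℚ (ℕ.suc n)) → u · v ≡ u zero * v zero + (u ∘ suc) · (v ∘ suc)
  ·-suc {n} u v = ∑-allFin-suc n (λ k → u k * v k)

  module Elimination {m} (w : Fin (ℕ.suc m) → Vector ℚ (ℕ.suc (ℕ.suc m)))
                     (p : Fin (ℕ.suc m)) (pivot≢0 : w p zero ≢ 0ℚ) where

    open ℚ-Solver.+-*-Solver

    private
      r = w p zero
      instance
        r-nonZero : ℚ.NonZero r
        r-nonZero = ℚ.≢-nonZero pivot≢0

    multiplier : Fin m → ℚ
    multiplier j = - (w (punchIn p j) zero * 1/ r)

    reduced : Fin m → Vector ℚ (ℕ.suc m)
    reduced j k = w (punchIn p j) (suc k) + multiplier j * w p (suc k)

    module _ (u′ : Vector ℚ (ℕ.suc m)) (u′-orthogonal : ∀ j → u′ · reduced j ≡ 0ℚ) where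

      private
        D = u′ · (w p ∘ suc)

      lift : Vector ℚ (ℕ.suc (ℕ.suc m))
      lift zero    = - (D * 1/ r)
      lift (suc k) = u′ k

      lift-orthogonal-pivot : lift · w p ≡ 0ℚ
      lift-orthogonal-pivot = begin
        lift · w p                       ≡⟨ ·-suc lift (w p) ⟩
        - (D * 1/ r) * r + D             ≡⟨ solve 3 (λ D i r → (:- (D :* i)) :* r :+ D := D :* (con 1ℚ :- i :* r)) refl D (1/ r) r ⟩
        D * (1ℚ + - (1/ r * r))          ≡⟨ cong (λ z → D * (1ℚ + - z)) (ℚ.*-inverseˡ r) ⟩
        D * (1ℚ + - 1ℚ)                  ≡⟨ ℚ.*-zeroʳ D ⟩
        0ℚ                               ∎
        where open ≡-Reasoning

      lift-orthogonal-other : ∀ j → lift · w (punchIn p j) ≡ 0ℚ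
      lift-orthogonal-other j = begin
        lift · w (punchIn p j)                                         ≡⟨ ·-suc lift (w (punchIn p j)) ⟩
        lift zero * x + A                                              ≡⟨ solve 4 (λ u₀ x A cD → u₀ :* x :+ A := (u₀ :* x :- cD) :+ (A :+ cD)) refl (lift zero) x A cD ⟩
        (lift zero * x + - cD) + (A + cD)                              ≡⟨ cong₂ _+_ eliminated reduced-orthogonal ⟩
        0ℚ + 0ℚ                                                        ≡⟨ ℚ.+-identityˡ 0ℚ ⟩
        0ℚ                                                             ∎
        where
        open ≡-Reasoning
        x = w (punchIn p j) zero
        A = u′ · (w (punchIn p j) ∘ suc)
        cD = multiplier j * D
        eliminated : lift zero * x + - cD ≡ 0ℚ
        eliminated = solve 3 (λ D i x → (:- (D :* i)) :* x :- (:- (x :* i)) :* D := con 0ℚ) refl D (1/ r) x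
        reduced-orthogonal : A + cD ≡ 0ℚ
        reduced-orthogonal = trans (sym (trans (·-distrib-+ u′ _ _) (cong (A +_) (·-scale u′ (multiplier j) (w p ∘ suc))))) (u′-orthogonal j)

      lift-orthogonal : ∀ i → lift · w i ≡ 0ℚ
      lift-orthogonal i with i ≟ p
      ... | yes refl = lift-orthogonal-pivot
      ... | no i≢p   = subst (λ i → lift · w i ≡ 0ℚ) (Fin.punchIn-punchOut (i≢p ∘ sym)) (lift-orthogonal-other (punchOut (i≢p ∘ sym)))

  e₀ : ∀ {n} → Vector ℚ (ℕ.suc n)
  e₀ zero    = 1ℚ
  e₀ (suc _) = 0ℚ

  e₀-orthogonal : ∀ {m n} (w : Fin m → Vector ℚ (ℕ.suc n)) → (∀ i → w i zero ≡ 0ℚ) → ∀ i → e₀ · w i ≡ 0ℚ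
  e₀-orthogonal {n = n} w column≡0 i = begin
    e₀ · w i                                          ≡⟨ ·-suc e₀ (w i) ⟩
    1ℚ * w i zero + (λ _ → 0ℚ) · (w i ∘ suc)          ≡⟨ cong₂ _+_ (trans (ℚ.*-identityˡ _) (column≡0 i)) (∑-zero (allFin n) (λ k → ℚ.*-zeroˡ (w i (suc k)))) ⟩
    0ℚ + 0ℚ                                           ≡⟨ ℚ.+-identityˡ 0ℚ ⟩
    0ℚ                                                ∎
    where open ≡-Reasoning

  nonzero-orthogonal : ∀ m (w : Fin m → Vector ℚ (ℕ.suc m)) →
                       ∃ λ (u : Vector ℚ (ℕ.suc m)) → (∃ λ j → u j ≢ 0ℚ) × (∀ i → u · w i ≡ 0ℚ)
  nonzero-orthogonal ℕ.zero    w = (λ _ → 1ℚ) , (zero , λ ()) , λ ()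
  nonzero-orthogonal (ℕ.suc m) w with Fin.any? (λ i → ¬? (w i zero ℚ.≟ 0ℚ))
  ... | no no-pivot = e₀ , (zero , λ ()) , e₀-orthogonal w (λ i → decidable-stable (w i zero ℚ.≟ 0ℚ) (λ ≢0 → no-pivot (i , ≢0)))
  ... | yes (p , pivot≢0) with u′ , (j , u′j≢0) , u′-orthogonal ← nonzero-orthogonal m (Elimination.reduced w p pivot≢0) =
    Elimination.lift w p pivot≢0 u′ u′-orthogonal , (suc j , u′j≢0) , Elimination.lift-orthogonal w p pivot≢0 u′ u′-orthogonal

  x+x≡0⇒x≡0 : ∀ x → x + x ≡ 0ℚ → x ≡ 0ℚ
  x+x≡0⇒x≡0 x x+x≡0 = begin
    x               ≡⟨ solve 1 (λ x → x := con ℚ.½ :* (x :+ x)) refl x ⟩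
    ℚ.½ * (x + x)   ≡⟨ cong (ℚ.½ *_) x+x≡0 ⟩
    ℚ.½ * 0ℚ        ≡⟨ ℚ.*-zeroʳ ℚ.½ ⟩
    0ℚ              ∎
    where
    open ≡-Reasoning
    open ℚ-Solver.+-*-Solver

  ∑∑-antisymmetric : ∀ {A : Set} (xs : List A) (g : A → A → ℚ) → (∀ x y → g x y + g y x ≡ 0ℚ) →
                     ∑[ x ∈ xs ] ∑[ y ∈ xs ] g x y ≡ 0ℚ
  ∑∑-antisymmetric xs g antisymmetric = x+x≡0⇒x≡0 S (begin
    S + S                                                       ≡⟨ cong (S +_) (∑-comm xs xs g) ⟩
    S + ∑[ x ∈ xs ] ∑[ y ∈ xs ] g y x                           ≡⟨ sym (∑-distrib-+ xs _ _) ⟩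
    ∑[ x ∈ xs ] (∑[ y ∈ xs ] g x y + ∑[ y ∈ xs ] g y x)         ≡⟨ ∑-cong xs (λ x → sym (∑-distrib-+ xs _ _)) ⟩
    ∑[ x ∈ xs ] ∑[ y ∈ xs ] (g x y + g y x)                     ≡⟨ ∑-zero xs (λ x → ∑-zero xs (antisymmetric x)) ⟩
    0ℚ                                                          ∎)
    where
    open ≡-Reasoning
    S = ∑[ x ∈ xs ] ∑[ y ∈ xs ] g x y

module ℕ→ℚ-Properties where

  open import Data.Rational using (mkℚ; _/_; _+_; _*_)
  open ≡ hiding ([_])
  module ℕΣ = Sums ℕ.+-*-commutativeSemiring
  open Sums (CommutativeRing.commutativeSemiring ℚ.+-*-commutativeRing)

  ℕ→ℚ≡mkℚ : ∀ n → ℕ→ℚ n ≡ mkℚ (ℤ.+ n) 0 (coprime-sym (1-coprimeTo n))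
  ℕ→ℚ≡mkℚ n = ℚ.normalize-coprime (coprime-sym (1-coprimeTo n))

  ℕ→ℚ-+ : ∀ m n → ℕ→ℚ (m ℕ.+ n) ≡ ℕ→ℚ m + ℕ→ℚ n
  ℕ→ℚ-+ m n = sym (trans (cong₂ _+_ (ℕ→ℚ≡mkℚ m) (ℕ→ℚ≡mkℚ n))
                         (cong (_/ 1) (cong₂ ℤ._+_ (ℤ.*-identityʳ (ℤ.+ m)) (ℤ.*-identityʳ (ℤ.+ n)))))

  ℕ→ℚ-* : ∀ m n → ℕ→ℚ (m ℕ.* n) ≡ ℕ→ℚ m * ℕ→ℚ n
  ℕ→ℚ-* m n = sym (trans (cong₂ _*_ (ℕ→ℚ≡mkℚ m) (ℕ→ℚ≡mkℚ n)) (cong (_/ 1) (sym (ℤ.pos-* m n))))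

  ℕ→ℚ-∑ : ∀ {A : Set} (xs : List A) (f : A → ℕ) → ℕ→ℚ (ℕΣ.∑[ x ∈ xs ] f x) ≡ ∑[ x ∈ xs ] ℕ→ℚ (f x)
  ℕ→ℚ-∑ []       f = refl
  ℕ→ℚ-∑ (x ∷ xs) f = trans (ℕ→ℚ-+ (f x) _) (cong (ℕ→ℚ (f x) +_) (ℕ→ℚ-∑ xs f))

  ℕ→ℚ-𝟙 : ∀ {P : Set} (d : Dec P) → ℕ→ℚ (ℕΣ.𝟙 d) ≡ 𝟙 d
  ℕ→ℚ-𝟙 (yes _) = refl
  ℕ→ℚ-𝟙 (no _)  = refl

module SixPartitions (n : ℕ) (12≤n : 12 ≤ n) where

  open import Data.Nat using (_∸_; _!; z≤n; s≤s)
  open import Data.Rational using (ℚ; 0ℚ; _+_; _*_)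
  open ≡ hiding ([_])
  open Counting using (twoVertexCount; homCount-of-wrong-size; homCount-two-parts; edgeless-or-edge;
                       twoVertexCount-edgeless; twoVertexCount-edge; mScalar-two-parts; _≟ₗ_)
  open LinearAlgebra
  open ℕ→ℚ-Properties using (ℕ→ℚ-*; ℕ→ℚ-∑; ℕ→ℚ-𝟙)
  module ℕΣ = Sums ℕ.+-*-commutativeSemiring
  open Sums (CommutativeRing.commutativeSemiring ℚ.+-*-commutativeRing)

  small : Fin 6 → ℕ
  small k = ℕ.suc (toℕ k)

  large : Fin 6 → ℕ
  large k = n ∸ small k

  small≤6 : ∀ k → small k ≤ 6
  small≤6 k = Fin.toℕ<n k

  small≤large : ∀ k → small k ≤ large k
  small≤large k = ℕ.≤-trans (small≤6 k) (ℕ.≤-trans (ℕ.∸-monoˡ-≤ 6 12≤n) (ℕ.∸-monoʳ-≤ n (small≤6 k)))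

  large+small : ∀ k → large k ℕ.+ small k ≡ n
  large+small k = ℕ.m∸n+n≡m (ℕ.≤-trans (small≤6 k) (ℕ.≤-trans (ℕ.m≤m+n 6 6) 12≤n))

  part : Fin 6 → Partition
  part k = (large k ∷ small k ∷ []) , (ℕ.≤-trans (s≤s z≤n) (small≤large k) ∷ s≤s z≤n ∷ []) , (small≤large k ∷ [-])

  ∣part∣ : ∀ k → ∣ part k ∣ₚ ≡ n
  ∣part∣ k = trans (cong (large k ℕ.+_) (ℕ.+-identityʳ (small k))) (large+small k)

  indicator : Fin 6 → SymFun
  indicator j μ = 𝟙 (proj₁ μ ≟ₗ proj₁ (part j))

  indicator∈Λ : ∀ j → InΛ n (indicator j)
  indicator∈Λ j μ ∣μ∣≢n = 𝟙-no (proj₁ μ ≟ₗ proj₁ (part j)) (λ μ≡part → ∣μ∣≢n (trans (cong sum μ≡part) (∣part∣ j)))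

  indicator-part : ∀ j k → indicator j (part k) ≡ 𝟙 (k Fin.≟ j)
  indicator-part j k = 𝟙-cong (proj₁ (part k) ≟ₗ proj₁ (part j)) (k Fin.≟ j) same-small (cong (proj₁ ∘ part))
    where
    same-small : proj₁ (part k) ≡ proj₁ (part j) → k ≡ j
    same-small parts≡ = Fin.toℕ-injective (ℕ.suc-injective (cong (λ { (_ ∷ s ∷ _) → s ; _ → 0 }) parts≡))

  module _ (G : Graph) where

    column : (loop₀ edge loop₁ : Bool) → Vector ℚ 6
    column p e q k = ℕ→ℚ (twoVertexCount G (large k) (small k) p e q)

    X-at-part : ∀ H → size G ≡ n → ∀ k →
      X G H (part k) ≡ ℕ→ℚ ((size H ∸ 2) !) *
                       ∑[ x ∈ allFin (size H) ] ∑[ y ∈ allFin (size H) ] (𝟙 (¬? (x Fin.≟ y)) * column (adj H x x) (adj H x y) (adj H y y) k)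
    X-at-part H size≡n k = begin
      ℕ→ℚ (homCount G H (part k) ℕ.* mScalar (size H) (part k))
        ≡⟨ cong (λ m → ℕ→ℚ (homCount G H (part k) ℕ.* m)) (mScalar-two-parts (size H) (proj₂ (part k)) (s≤s z≤n)) ⟩
      ℕ→ℚ (homCount G H (part k) ℕ.* ((1 ℕ.+ e) ℕ.* F))
        ≡⟨ cong ℕ→ℚ (trans (sym (ℕ.*-assoc (homCount G H (part k)) (1 ℕ.+ e) F)) (cong (ℕ._* F) (ℕ.*-comm (homCount G H (part k)) (1 ℕ.+ e)))) ⟩
      ℕ→ℚ ((1 ℕ.+ e) ℕ.* homCount G H (part k) ℕ.* F)
        ≡⟨ cong (λ m → ℕ→ℚ (m ℕ.* F)) (homCount-two-parts G H (proj₂ (part k)) (trans (large+small k) (sym size≡n)) (s≤s z≤n) (small≤large k)) ⟩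
      ℕ→ℚ (V ℕ.* F)
        ≡⟨ trans (cong ℕ→ℚ (ℕ.*-comm V F)) (ℕ→ℚ-* F V) ⟩
      ℕ→ℚ F * ℕ→ℚ V
        ≡⟨ cong (ℕ→ℚ F *_) (trans (ℕ→ℚ-∑ (allFin (size H)) _) (∑-cong (allFin (size H)) (λ x →
             trans (ℕ→ℚ-∑ (allFin (size H)) _) (∑-cong (allFin (size H)) (cast-term x))))) ⟩
      ℕ→ℚ F * ∑[ x ∈ allFin (size H) ] ∑[ y ∈ allFin (size H) ] (𝟙 (¬? (x Fin.≟ y)) * column (adj H x x) (adj H x y) (adj H y y) k)
        ∎
      where
      open ≡-Reasoning
      e = ℕΣ.𝟙 (large k ℕ.≟ small k)
      F = (size H ∸ 2) !
      count : Fin (size H) → Fin (size H) → ℕ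
      count x y = twoVertexCount G (large k) (small k) (adj H x x) (adj H x y) (adj H y y)
      V = ℕΣ.∑[ x ∈ allFin (size H) ] ℕΣ.∑[ y ∈ allFin (size H) ] (ℕΣ.𝟙 (¬? (x Fin.≟ y)) ℕ.* count x y)
      cast-term : ∀ x y → ℕ→ℚ (ℕΣ.𝟙 (¬? (x Fin.≟ y)) ℕ.* count x y) ≡ 𝟙 (¬? (x Fin.≟ y)) * column (adj H x x) (adj H x y) (adj H y y) k
      cast-term x y = trans (ℕ→ℚ-* (ℕΣ.𝟙 (¬? (x Fin.≟ y))) (count x y)) (cong (_* ℕ→ℚ (count x y)) (ℕ→ℚ-𝟙 (¬? (x Fin.≟ y))))

    -- Each column p e q + column q e p is a multiple of one of these rows, except when
    -- (p, e, q) = (false, false, false), which φ-empty handles.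
    rows : Fin 5 → Vector ℚ 6
    rows zero                         = column false true  false
    rows (suc zero)                   = column true  false true
    rows (suc (suc zero))             = column true  true  true
    rows (suc (suc (suc zero)))       = λ k → column true false false k + column false false true k
    rows (suc (suc (suc (suc zero)))) = λ k → column true true  false k + column false true  true k

    module Functional (u : Vector ℚ 6) (u⊥rows : ∀ i → u · rows i ≡ 0ℚ) where

      φ : (loop₀ edge loop₁ : Bool) → ℚ
      φ p e q = u · column p e q

      φ-empty : φ false false false ≡ 0ℚ
      φ-empty = [ edgeless , (λ { (_ , _ , uv) → edge uv }) ]′ (edgeless-or-edge G)
        where
        edgeless : (∀ a b → adj G a b ≡ false) → φ false false false ≡ 0ℚ
        edgeless no-edges = trans (·-cong u {column false false false} {column false true false}
                                         (λ k → cong ℕ→ℚ (twoVertexCount-edgeless G no-edges (large k) (small k))))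
                                  (u⊥rows zero)
        edge : ∀ {a b} → adj G a b ≡ true → φ false false false ≡ 0ℚ
        edge ab = trans (·-cong u {column false false false} {λ _ → 0ℚ} (λ k → cong ℕ→ℚ (twoVertexCount-edge G ab (large k) (small k))))
                        (·-zero u)

      φ-antisymmetric : ∀ p e q → φ p e q + φ q e p ≡ 0ℚ
      φ-antisymmetric false false false = cong₂ _+_ φ-empty φ-empty
      φ-antisymmetric false true  false = cong₂ _+_ (u⊥rows zero) (u⊥rows zero)
      φ-antisymmetric true  false true  = cong₂ _+_ (u⊥rows (suc zero)) (u⊥rows (suc zero))
      φ-antisymmetric true  true  true  = cong₂ _+_ (u⊥rows (suc (suc zero))) (u⊥rows (suc (suc zero)))
      φ-antisymmetric true  false false = trans (sym (·-distrib-+ u (column true false false) (column false false true))) (u⊥rows (suc (suc (suc zero))))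
      φ-antisymmetric true  true  false = trans (sym (·-distrib-+ u (column true true false) (column false true true))) (u⊥rows (suc (suc (suc (suc zero)))))
      φ-antisymmetric false false true  = trans (ℚ.+-comm (φ false false true) (φ true false false)) (φ-antisymmetric true false false)
      φ-antisymmetric false true  true  = trans (ℚ.+-comm (φ false true true) (φ true true false)) (φ-antisymmetric true true false)

      ψ : SymFun → ℚ
      ψ v = u · (v ∘ part)

      ψ-X-wrong-size : ∀ H → size G ≢ n → ψ (X G H) ≡ 0ℚ
      ψ-X-wrong-size H size≢n = trans (·-cong u {X G H ∘ part} {λ _ → 0ℚ} no-homs) (·-zero u)
        where
        no-homs : ∀ k → X G H (part k) ≡ 0ℚ
        no-homs k = cong (λ c → ℕ→ℚ (c ℕ.* mScalar (size H) (part k)))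
                         (homCount-of-wrong-size G H (part k) (λ ∣part∣≡size → size≢n (trans (sym ∣part∣≡size) (∣part∣ k))))

      ψ-X-right-size : ∀ H → size G ≡ n → ψ (X G H) ≡ 0ℚ
      ψ-X-right-size H size≡n = begin
        u · (X G H ∘ part)                                                    ≡⟨ ·-cong u {X G H ∘ part} {λ k → c * T k} (X-at-part H size≡n) ⟩
        u · (λ k → c * T k)                                                   ≡⟨ ·-scale u c T ⟩
        c * u · T                                                             ≡⟨ cong (c *_) u·T ⟩
        c * ∑[ x ∈ V ] ∑[ y ∈ V ] (off x y * u · column′ x y)                 ≡⟨ cong (c *_) (∑∑-antisymmetric V _ antisymmetric) ⟩
        c * 0ℚ                                                                ≡⟨ ℚ.*-zeroʳ c ⟩
        0ℚ                                                                    ∎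
        where
        open ≡-Reasoning
        c = ℕ→ℚ ((size H ∸ 2) !)
        V = allFin (size H)
        off : Fin (size H) → Fin (size H) → ℚ
        off x y = 𝟙 (¬? (x Fin.≟ y))
        column′ : Fin (size H) → Fin (size H) → Vector ℚ 6
        column′ x y = column (adj H x x) (adj H x y) (adj H y y)
        T : Vector ℚ 6
        T k = ∑[ x ∈ V ] ∑[ y ∈ V ] (off x y * column′ x y k)
        u·T : u · T ≡ ∑[ x ∈ V ] ∑[ y ∈ V ] (off x y * u · column′ x y)
        u·T = trans (·-∑ u V (λ x k → ∑[ y ∈ V ] (off x y * column′ x y k)))
                    (∑-cong V (λ x → trans (·-∑ u V (λ y k → off x y * column′ x y k))
                                           (∑-cong V (λ y → ·-scale u (off x y) (column′ x y)))))
        antisymmetric : ∀ x y → off x y * u · column′ x y + off y x * u · column′ y x ≡ 0ℚ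
        antisymmetric x y = begin
          off x y * φ (adj H x x) (adj H x y) (adj H y y) + off y x * φ (adj H y y) (adj H y x) (adj H x x)
            ≡⟨ cong₂ (λ o a → off x y * φ (adj H x x) (adj H x y) (adj H y y) + o * φ (adj H y y) a (adj H x x))
                     (𝟙-cong (¬? (y Fin.≟ x)) (¬? (x Fin.≟ y)) (λ y≢x → y≢x ∘ sym) (λ x≢y → x≢y ∘ sym)) (Graph.sym H y x) ⟩
          off x y * φ (adj H x x) (adj H x y) (adj H y y) + off x y * φ (adj H y y) (adj H x y) (adj H x x)
            ≡⟨ sym (ℚ.*-distribˡ-+ (off x y) _ _) ⟩
          off x y * (φ (adj H x x) (adj H x y) (adj H y y) + φ (adj H y y) (adj H x y) (adj H x x))
            ≡⟨ cong (off x y *_) (φ-antisymmetric (adj H x x) (adj H x y) (adj H y y)) ⟩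
          off x y * 0ℚ
            ≡⟨ ℚ.*-zeroʳ (off x y) ⟩
          0ℚ ∎

      ψ-X : ∀ H → ψ (X G H) ≡ 0ℚ
      ψ-X H = [ ψ-X-right-size H , ψ-X-wrong-size H ]′ (toSum (size G ℕ.≟ n))

      ψ-linComb : ∀ {I : Set} (F : I → SymFun) → (∀ i → ψ (F i) ≡ 0ℚ) → ∀ L → ψ (linComb F L) ≡ 0ℚ
      ψ-linComb F ψF≡0 []            = ·-zero u
      ψ-linComb F ψF≡0 ((c , i) ∷ L) = begin
        u · (λ k → c * F i (part k) + linComb F L (part k))   ≡⟨ ·-distrib-+ u (λ k → c * F i (part k)) (linComb F L ∘ part) ⟩
        u · (λ k → c * F i (part k)) + ψ (linComb F L)        ≡⟨ cong₂ _+_ (trans (·-scale u c (F i ∘ part)) (cong (c *_) (ψF≡0 i))) (ψ-linComb F ψF≡0 L) ⟩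
        c * 0ℚ + 0ℚ                                           ≡⟨ trans (ℚ.+-identityʳ _) (ℚ.*-zeroʳ c) ⟩
        0ℚ                                                    ∎
        where open ≡-Reasoning

      ψ-indicator : ∀ j → ψ (indicator j) ≡ u j
      ψ-indicator j = trans (·-cong u {indicator j ∘ part} {λ k → 𝟙 (k Fin.≟ j)} (indicator-part j)) (·-δ u j)

proposition4p12 : (n : ℕ) → 12 ≤ n →
    ¬ (Σ Graph λ G → Σ (Par n → Graph) λ H → Spans n (λ lam → X G (H lam)))
proposition4p12 n 12≤n (G , H , _ , spans) = absurd (nonzero-orthogonal 5 (rows G))
  where
  open SixPartitions n 12≤n
  open LinearAlgebra using (_·_; ·-cong; nonzero-orthogonal)
  absurd : (∃ λ u → (∃ λ j → u j ≢ ℚ.0ℚ) × (∀ i → u · rows G i ≡ ℚ.0ℚ)) → ⊥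
  absurd (u , (j , uj≢0) , u⊥rows) = uj≢0 (uj≡0 (spans (indicator j) (indicator∈Λ j)))
    where
    open Functional G u u⊥rows
    open ≡.≡-Reasoning
    uj≡0 : (∃ λ L → ∀ μ → linComb (X G ∘ H) L μ ≡ indicator j μ) → u j ≡ ℚ.0ℚ
    uj≡0 (L , L≡indicator) = begin
      u j                       ≡⟨ ψ-indicator j ⟨
      ψ (indicator j)           ≡⟨ ·-cong u {linComb (X G ∘ H) L ∘ part} {indicator j ∘ part} (L≡indicator ∘ part) ⟨
      ψ (linComb (X G ∘ H) L)   ≡⟨ ψ-linComb (X G ∘ H) (ψ-X ∘ H) L ⟩
      ℚ.0ℚ                      ∎
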